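{- Let $\nu$ be a ribbon with ${\operatorname{cont}}(\nu)=\beta\in\Psi$. Then $\nu$ is cuspidal if and only if $\nu=\zeta^{(\beta,\nu_{\sf SW})}$.
   Context: Nodes are elements of $\mathbb{Z}\times\mathbb{Z}$; $u=(u_1,u_2)$ lies in row $u_1$ (increasing southward), column $u_2$ (increasing eastward). ${\sf N}(i,j)=(i-1,j)$, ${\sf E}(i,j)=(i,j+1)$, ${\sf S}(i,j)=(i+1,j)$, ${\sf W}(i,j)=(i,j-1)$. $u\searrow v$ means $v=u+(k,\ell)$, $k,\ell\ge0$; $u\nearrow v$ means $v=u+(-k,\ell)$, $k,\ell\ge0$. A finite set $\tau$ of nodes is a skew shape if $u,w\in\tau$, $u\searrow v\searrow w$ imply $v\in\tau$; connected if any two nodes are joined by a path of ${\sf N},{\sf E},{\sf S},{\sf W}$ steps in $\tau$; thin if it meets each diagonal $\{u:u_2-u_1=n\}$ in at most one node. A ribbon is a nonempty thin connected skew shape. For a nonempty skew shape $\nu$, $\nu_{\sf SW}$ is the unique node $u\in\nu$ such that no $v\neq u$ in $\nu$ satisfies $v\nearrow u$. Fix $e\ge2$; $\alpha_t$ ($t\in\mathbb{Z}_e$) basis of a free $\mathbb{Z}$-module, ${\operatorname{ht}}(\sum c_t\alpha_t)=\sum c_t$, $\alpha(t,h)=\sum_{i=0}^{h-1}\alpha_{t+\bar i}$, $\delta=\sum_t\alpha_t$; $\Phi_+=\{\alpha(t,h)\}$; real roots: $e\nmid h$; imaginary: $m\delta$; $\Psi=\Phi^{\mathrm{re}}_+\cup\{\delta\}$.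 Fix a convex preorder $\succeq$ on $\Phi_+$ (reflexive, transitive, total; $\beta\succeq\gamma$, $\beta+\gamma\in\Phi_+$ imply $\beta\succeq\beta+\gamma\succeq\gamma$; ($\beta\succeq\gamma$ and $\gamma\succeq\beta$) iff $\beta=\gamma$ or both imaginary); $\succ$ strict part. $\operatorname{res}(u)=\overline{u_2-u_1}$, ${\operatorname{cont}}(\tau)=\sum_{u\in\tau}\alpha_{\operatorname{res}(u)}$. A tableau $(\lambda_1,\lambda_2)$ for a skew shape $\tau$ is a pair of disjoint nonempty skew shapes with union $\tau$ such that no $u\in\lambda_2$, $v\in\lambda_1$ satisfy $u\searrow v$. A skew shape $\tau$ with ${\operatorname{cont}}(\tau)=\beta\in\Phi_+$ is cuspidal if for every tableau $(\lambda_1,\lambda_2)$ for $\tau$, ${\operatorname{cont}}(\lambda_1)$ is a sum of positive roots $\prec\beta$ and ${\operatorname{cont}}(\lambda_2)$ a sum of positive roots $\succ\beta$. For $\beta\in\Psi$ and a node $b$ with $\alpha(\operatorname{res}(b),{\operatorname{ht}}\beta)=\beta$, let $z^1=b$ and for $2\le i\le{\operatorname{ht}}\beta$, $z^i={\sf N}z^{i-1}$ if $\alpha(\operatorname{res}(b),i-1)\succ\beta$ and $z^i={\sf E}z^{i-1}$ if $\beta\succ\alpha(\operatorname{res}(b),i-1)$; $\zeta^{(\beta,b)}=\{z^1,\dots,z^{{\operatorname{ht}}\beta}\}$. -}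

module Defs where

open import Data.Nat as ℕ using (ℕ; zero; suc; NonZero; _%_)
open import Data.Nat.Divisibility using (_∣_)
open import Data.Integer as ℤ using (ℤ; +_; _%ℕ_)
open import Data.Product using (Σ; ∃; ∃-syntax; _×_; _,_; proj₁; proj₂)
open import Data.Sum using (_⊎_)
open import Data.Empty using (⊥)
open import Data.Bool using (if_then_else_)
open import Data.Fin using (Fin; toℕ)
open import Data.List using (List; []; _∷_; map; foldr)
open import Data.List.Membership.Propositional using (_∈_)
open import Data.List.Relation.Unary.All using (All)
open import Data.List.Relation.Unary.Unique.Propositional using (Unique)
open import Data.Vec as Vec using (Vec; tabulate; zipWith; replicate)
open import Relation.Binary.PropositionalEquality using (_≡_; _≢_)
open import Relation.Nullary using (¬_)
open import Function.Bundles using (_⇔_)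

Node : Set
Node = ℤ × ℤ

row col : Node → ℤ
row = proj₁
col = proj₂

N E S W : Node → Node
N (i , j) = (i ℤ.- + 1 , j)
E (i , j) = (i , j ℤ.+ + 1)
S (i , j) = (i ℤ.+ + 1 , j)
W (i , j) = (i , j ℤ.- + 1)

_↘_ : Node → Node → Set
u ↘ v = ∃[ k ] ∃[ ℓ ] (v ≡ (row u ℤ.+ + k , col u ℤ.+ + ℓ))

_↗_ : Node → Node → Set
u ↗ v = ∃[ k ] ∃[ ℓ ] (v ≡ (row u ℤ.- + k , col u ℤ.+ + ℓ))

-- Finite sets of nodes are represented by duplicate-free lists.

Shape : Set
Shape = List Node

IsSkew : Shape → Set
IsSkew τ = ∀ u v w → u ∈ τ → w ∈ τ → u ↘ v → v ↘ w → v ∈ τ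

SkewShape : Shape → Set
SkewShape τ = Unique τ × IsSkew τ

Adjacent : Node → Node → Set
Adjacent u w = (w ≡ N u) ⊎ (w ≡ E u) ⊎ (w ≡ S u) ⊎ (w ≡ W u)

data Path (τ : Shape) : Node → Node → Set where
  here : ∀ {u} → u ∈ τ → Path τ u u
  step : ∀ {u w v} → u ∈ τ → Adjacent u w → Path τ w v → Path τ u v

Connected : Shape → Set
Connected τ = ∀ u v → u ∈ τ → v ∈ τ → Path τ u v

diag : Node → ℤ
diag u = col u ℤ.- row u

Thin : Shape → Set
Thin τ = ∀ u v → u ∈ τ → v ∈ τ → diag u ≡ diag v → u ≡ v

Ribbon : Shape → Set
Ribbon τ = SkewShape τ × (τ ≢ []) × Thin τ × Connected τ

IsSW : Shape → Node → Set
IsSW ν u = u ∈ ν × (∀ v → v ∈ ν → v ↗ u → v ≡ u)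

_≈ˢ_ : Shape → Shape → Set
τ ≈ˢ σ = ∀ u → (u ∈ τ) ⇔ (u ∈ σ)

-- Root lattice for fixed e: elements of ⊕_{t ∈ ℤ_e} ℕ α_t as Vec ℕ e
-- (all elements occurring here have non-negative coefficients).

module _ (e : ℕ) {{_ : NonZero e}} where

  Wt : Set
  Wt = Vec ℕ e

  zeroW : Wt
  zeroW = replicate e 0

  _⊕_ : Wt → Wt → Wt
  _⊕_ = zipWith ℕ._+_

  sumW : List Wt → Wt
  sumW = foldr _⊕_ zeroW

  unit : ℕ → Wt
  unit r = tabulate (λ s → if toℕ s ℕ.≡ᵇ (r % e) then 1 else 0)

  ht : Wt → ℕ
  ht = Vec.sum

  α : ℕ → ℕ → Wt
  α t zero    = zeroW
  α t (suc h) = α t h ⊕ unit (t ℕ.+ h)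

  δ : Wt
  δ = replicate e 1

  mulδ : ℕ → Wt
  mulδ m = replicate e m

  PosRoot : Wt → Set
  PosRoot β = Σ (Fin e) λ t → Σ ℕ λ h → (1 ℕ.≤ h) × (β ≡ α (toℕ t) h)

  RealRoot : Wt → Set
  RealRoot β = Σ (Fin e) λ t → Σ ℕ λ h → (1 ℕ.≤ h) × ¬ (e ∣ h) × (β ≡ α (toℕ t) h)

  ImagRoot : Wt → Set
  ImagRoot β = Σ ℕ λ m → (1 ℕ.≤ m) × (β ≡ mulδ m)

  InΨ : Wt → Set
  InΨ β = RealRoot β ⊎ (β ≡ δ)

  res : Node → ℕ
  res u = diag u %ℕ e

  cont : Shape → Wt
  cont τ = sumW (map (λ u → unit (res u)) τ)

  -- Convex preorders on Φ₊ (the relation is only constrained on Φ₊)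

  record ConvexPreorder : Set₁ where
    field
      _≽_     : Wt → Wt → Set
      ≽-refl  : ∀ β → PosRoot β → β ≽ β
      ≽-trans : ∀ β γ η → PosRoot β → PosRoot γ → PosRoot η →
                β ≽ γ → γ ≽ η → β ≽ η
      ≽-total : ∀ β γ → PosRoot β → PosRoot γ → (β ≽ γ) ⊎ (γ ≽ β)
      convex  : ∀ β γ → PosRoot β → PosRoot γ → β ≽ γ → PosRoot (β ⊕ γ) →
                (β ≽ (β ⊕ γ)) × ((β ⊕ γ) ≽ γ)
      ≽-antisym : ∀ β γ → PosRoot β → PosRoot γ →
                ((β ≽ γ) × (γ ≽ β)) ⇔ ((β ≡ γ) ⊎ (ImagRoot β × ImagRoot γ))

    _≻_ : Wt → Wt → Set
    β ≻ γ = (β ≽ γ) × ¬ (γ ≽ β)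

  module _ (P : ConvexPreorder) where
    open ConvexPreorder P

    SumOfRoots : (Wt → Set) → Wt → Set
    SumOfRoots Q x = Σ (List Wt) λ L →
      All (λ γ → PosRoot γ × Q γ) L × (sumW L ≡ x)

    record Tableau (τ λ₁ λ₂ : Shape) : Set where
      field
        skew₁    : SkewShape λ₁
        skew₂    : SkewShape λ₂
        nonempty₁ : λ₁ ≢ []
        nonempty₂ : λ₂ ≢ []
        disjoint : ∀ u → u ∈ λ₁ → u ∈ λ₂ → ⊥
        union    : ∀ u → (u ∈ τ) ⇔ ((u ∈ λ₁) ⊎ (u ∈ λ₂))
        order    : ∀ u v → u ∈ λ₂ → v ∈ λ₁ → ¬ (u ↘ v)

    Cuspidal : Shape → Wt → Set
    Cuspidal τ β = ∀ λ₁ λ₂ → Tableau τ λ₁ λ₂ →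
      SumOfRoots (λ γ → β ≻ γ) (cont λ₁) × SumOfRoots (λ γ → γ ≻ β) (cont λ₂)

    -- z j = z^{j+1} (0-indexed) is a defining sequence for ζ^{(β,b)}
    ZetaSeq : Wt → Node → (ℕ → Node) → Set
    ZetaSeq β b z = (z 0 ≡ b) × (∀ j → suc j ℕ.< ht β →
      (α (res b) (suc j) ≻ β → z (suc j) ≡ N (z j)) ×
      (β ≻ α (res b) (suc j) → z (suc j) ≡ E (z j)))

    IsZeta : Wt → Node → Shape → Set
    IsZeta β b τ = Σ (ℕ → Node) λ z → ZetaSeq β b z ×
      (∀ u → (u ∈ τ) ⇔ (Σ ℕ λ j → (j ℕ.< ht β) × (z j ≡ u)))

-- A ribbon ν with ν_SW = b is a walk z₀ = b, z₁, …, z_{n-1} of north and east steps, one node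
-- per diagonal, and the first j + 1 nodes have content α(res b, j + 1).  Cutting the walk after
-- step j gives a tableau: (prefix, suffix) after an east step, (suffix, prefix) after a north
-- step.  Convexity makes the positive roots below β (and those above β) closed under sums that
-- are roots, so a string which is a sum of roots below β is itself below β.  Hence, if ν is
-- cuspidal, a step after which α(res b, j + 1) ≻ β must be north and one after which
-- β ≻ α(res b, j + 1) must be east: ν = ζ^(β,b).  Conversely, for ν = ζ^(β,b) the order
-- condition of a tableau (λ₁, λ₂) forces α(res b, a) ≻ β wherever a run of λ₁ starts at a > 0
-- and β ≻ α(res b, m) wherever it ends at m < n; convexity then puts each run of λ₁ below β
-- (a run ending at n is handled by heights, since only δ is imaginary in Ψ), and dually for λ₂.

module Submission where

open import Defs
open import Data.Nat as ℕ
  using (ℕ; zero; suc; NonZero; _%_; _+_; _∸_; _≤_; _<_; _≡ᵇ_; z≤n; s≤s)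
open import Data.Nat.Properties
open import Data.Nat.DivMod
open import Data.Nat.Divisibility using (_∣_; _∣?_; ∣-refl; n∣m*n; ∣m+n∣m⇒∣n; ∣⇒≤)
open import Data.Integer as ℤ using (ℤ; +_; -[1+_]; _%ℕ_)
import Data.Integer.Properties as ℤP
import Data.Integer.DivMod as ℤDivMod
open import Data.Integer.Tactic.RingSolver using (solve-∀)
open import Data.Bool using (Bool; true; false; if_then_else_; T; not)
open import Data.Bool.Properties using (not-injective)
open import Data.Fin using (Fin; toℕ; fromℕ<)
open import Data.Fin.Properties using (toℕ-fromℕ<; toℕ-injective; toℕ<n)
open import Data.Vec as Vec using (Vec; []; _∷_; lookup; tabulate; zipWith; replicate)
open import Data.Vec.Properties
  using (lookup-zipWith; lookup∘tabulate; lookup-replicate; zipWith-comm; zipWith-assoc; zipWith-identityʳ;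
         tabulate∘lookup; tabulate-cong)
open import Algebra.Properties.CommutativeSemigroup +-commutativeSemigroup using (interchange)
open import Data.List using (List; []; _∷_; length; map; applyUpTo)
open import Data.List.Properties using (length-removeAt′; length-applyUpTo)
open import Data.List.Membership.Propositional using (_∈_; _∉_; _─_; find; lose)
open import Data.List.Membership.Propositional.Properties using (∈-applyUpTo⁺; ∈-applyUpTo⁻)
open import Data.List.Relation.Binary.Subset.Propositional using (_⊆_)
open import Data.List.Relation.Unary.Any using (here; there; index; any?)
open import Data.List.Relation.Unary.All as All using (All; []; _∷_)
import Data.List.Relation.Unary.All.Properties as All
open import Data.List.Relation.Unary.AllPairs using ([]; _∷_)
open import Data.List.Relation.Unary.Unique.Propositional using (Unique)
open import Data.List.Relation.Unary.Unique.Propositional.Properties using (applyUpTo⁺₁)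
open import Data.Product using (Σ; _×_; _,_; proj₁; proj₂)
import Data.Product.Properties as Product
open import Data.Sum using (_⊎_; inj₁; inj₂; swap)
open import Function.Base using (_∘_)
open import Data.Empty using (⊥; ⊥-elim)
open import Relation.Nullary using (¬_; Dec; yes; no; does)
open import Relation.Binary.Definitions using (tri<; tri≈; tri>)
open import Relation.Binary.PropositionalEquality
open import Function.Bundles using (_⇔_; mk⇔; Equivalence)
import Data.List.Extrema ℤP.≤-totalOrder as Extrema

-- Residues modulo e

module _ (e : ℕ) .{{_ : NonZero e}} where

  suc-% : ∀ r → suc r % e ≡ suc (r % e) % e
  suc-% r = begin
    suc r % e                    ≡⟨ %-distribˡ-+ 1 r e ⟩
    (1 % e + r % e) % e          ≡⟨ cong (λ x → (1 % e + x) % e) (m%n%n≡m%n r e) ⟨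
    (1 % e + r % e % e) % e      ≡⟨ %-distribˡ-+ 1 (r % e) e ⟨
    suc (r % e) % e              ∎
    where open ≡-Reasoning

  suc-%-cases : ∀ {a} → a < e →
    (suc a % e ≡ suc a × suc a < e) ⊎ (suc a % e ≡ 0 × suc a ≡ e)
  suc-%-cases a<e with m≤n⇒m<n∨m≡n a<e
  ... | inj₁ lt = inj₁ (m<n⇒m%n≡m lt , lt)
  ... | inj₂ eq = inj₂ (trans (cong (_% e) eq) (n%n≡0 e) , eq)

  suc-%-injective : ∀ {a b} → a < e → b < e → suc a % e ≡ suc b % e → a ≡ b
  suc-%-injective a<e b<e eq with suc-%-cases a<e | suc-%-cases b<e
  ... | inj₁ (p , _) | inj₁ (q , _) = suc-injective (trans (sym p) (trans eq q))
  ... | inj₁ (p , _) | inj₂ (q , _) with () ← trans (sym p) (trans eq q)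
  ... | inj₂ (p , _) | inj₁ (q , _) with () ← trans (sym q) (trans (sym eq) p)
  ... | inj₂ (_ , p) | inj₂ (_ , q) = suc-injective (trans p (sym q))

  +-%-congˡ : ∀ {t t′} h → t % e ≡ t′ % e → (t + h) % e ≡ (t′ + h) % e
  +-%-congˡ {t} {t′} h eq = begin
    (t + h) % e              ≡⟨ %-distribˡ-+ t h e ⟩
    (t % e + h % e) % e      ≡⟨ cong (λ x → (x + h % e) % e) eq ⟩
    (t′ % e + h % e) % e     ≡⟨ %-distribˡ-+ t′ h e ⟨
    (t′ + h) % e             ∎
    where open ≡-Reasoning

  [t+h]%e≡t%e⇒e∣h : ∀ t h → (t + h) % e ≡ t % e → e ∣ h
  [t+h]%e≡t%e⇒e∣h t h eq = ∣m+n∣m⇒∣n (subst (e ∣_) quotients (n∣m*n ((t + h) / e))) (n∣m*n (t / e))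
    where
    quotients : (t + h) / e ℕ.* e ≡ t / e ℕ.* e + h
    quotients = +-cancelˡ-≡ (t % e) _ _ (begin
      t % e + (t + h) / e ℕ.* e    ≡⟨ cong (_+ (t + h) / e ℕ.* e) eq ⟨
      (t + h) % e + (t + h) / e ℕ.* e ≡⟨ m≡m%n+[m/n]*n (t + h) e ⟨
      t + h                         ≡⟨ cong (_+ h) (m≡m%n+[m/n]*n t e) ⟩
      t % e + t / e ℕ.* e + h       ≡⟨ +-assoc (t % e) _ h ⟩
      t % e + (t / e ℕ.* e + h)     ∎)
      where open ≡-Reasoning

  negResidue : ℕ → ℕ
  negResidue zero    = 0
  negResidue (suc c) = e ∸ suc c

  -[1+n]%ℕe : ∀ n → -[1+ n ] %ℕ e ≡ negResidue (suc n % e)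
  -[1+n]%ℕe n with suc n % e
  ... | zero  = refl
  ... | suc c = refl

  negResidue-suc : ∀ {r} → r < e → negResidue r ≡ suc (negResidue (suc r % e)) % e
  negResidue-suc {r} r<e with suc-%-cases r<e
  ... | inj₁ (p , _) = trans (below r r<e) (cong (λ x → suc (negResidue x) % e) (sym p))
    where
    below : ∀ r → r < e → negResidue r ≡ suc (negResidue (suc r)) % e
    below zero    r<e = trans (sym (n%n≡0 e)) (cong (_% e) (+-∸-assoc 1 r<e))
    below (suc c) r<e = trans (sym (m<n⇒m%n≡m (∸-monoʳ-< {e} {suc c} {0} (s≤s z≤n) (<⇒≤ r<e))))
                              (cong (_% e) (+-∸-assoc 1 r<e))
  ... | inj₂ (p , sr≡e) = trans (top r sr≡e) (cong (λ x → suc (negResidue x) % e) (sym p))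
    where
    top : ∀ r → suc r ≡ e → negResidue r ≡ 1 % e
    top zero    q = sym (trans (cong (_% e) q) (n%n≡0 e))
    top (suc c) q = trans (trans (cong (_∸ suc c) (sym q)) (m+n∸n≡m 1 (suc c)))
                          (sym (m<n⇒m%n≡m (subst (1 <_) q (s≤s (s≤s z≤n)))))

  [i+1]%ℕe : ∀ y → (y ℤ.+ + 1) %ℕ e ≡ suc (y %ℕ e) % e
  [i+1]%ℕe (+ n) = trans (cong (_% e) (+-comm n 1)) (suc-% n)
  [i+1]%ℕe -[1+ zero ] = begin
    0 % e                                     ≡⟨ m<n⇒m%n≡m (ℕ.>-nonZero⁻¹ e) ⟩
    negResidue 0                              ≡⟨ negResidue-suc (ℕ.>-nonZero⁻¹ e) ⟩
    suc (negResidue (1 % e)) % e              ≡⟨ cong (λ x → suc x % e) (-[1+n]%ℕe 0) ⟨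
    suc (-[1+ 0 ] %ℕ e) % e                   ∎
    where open ≡-Reasoning
  [i+1]%ℕe -[1+ suc k ] = begin
    -[1+ k ] %ℕ e                             ≡⟨ -[1+n]%ℕe k ⟩
    negResidue (suc k % e)                    ≡⟨ negResidue-suc (m%n<n (suc k) e) ⟩
    suc (negResidue (suc (suc k % e) % e)) % e ≡⟨ cong (λ x → suc (negResidue x) % e) (suc-% (suc k)) ⟨
    suc (negResidue (suc (suc k) % e)) % e    ≡⟨ cong (λ x → suc x % e) (-[1+n]%ℕe (suc k)) ⟨
    suc (-[1+ suc k ] %ℕ e) % e               ∎
    where open ≡-Reasoning

  [i+n]%ℕe : ∀ x j → (x ℤ.+ + j) %ℕ e ≡ (x %ℕ e + j) % e
  [i+n]%ℕe x zero = begin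
    (x ℤ.+ + 0) %ℕ e  ≡⟨ cong (_%ℕ e) (ℤP.+-identityʳ x) ⟩
    x %ℕ e            ≡⟨ m<n⇒m%n≡m (ℤDivMod.n%ℕd<d x e) ⟨
    x %ℕ e % e        ≡⟨ cong (_% e) (+-identityʳ _) ⟨
    (x %ℕ e + 0) % e  ∎
    where open ≡-Reasoning
  [i+n]%ℕe x (suc j) = begin
    (x ℤ.+ + suc j) %ℕ e         ≡⟨ cong (λ k → (x ℤ.+ + k) %ℕ e) (+-comm 1 j) ⟩
    (x ℤ.+ (+ j ℤ.+ + 1)) %ℕ e   ≡⟨ cong (_%ℕ e) (ℤP.+-assoc x (+ j) (+ 1)) ⟨
    ((x ℤ.+ + j) ℤ.+ + 1) %ℕ e   ≡⟨ [i+1]%ℕe (x ℤ.+ + j) ⟩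
    suc ((x ℤ.+ + j) %ℕ e) % e   ≡⟨ cong (λ k → suc k % e) ([i+n]%ℕe x j) ⟩
    suc ((x %ℕ e + j) % e) % e   ≡⟨ suc-% _ ⟨
    suc (x %ℕ e + j) % e         ≡⟨ cong (_% e) (+-suc _ j) ⟨
    (x %ℕ e + suc j) % e         ∎
    where open ≡-Reasoning

-- Lists without repetition

module _ {A : Set} where

  ∈-─⁻ : ∀ {x y : A} {xs} (p : x ∈ xs) → y ∈ xs ─ p → y ∈ xs
  ∈-─⁻ (here _)  q         = there q
  ∈-─⁻ (there p) (here eq) = here eq
  ∈-─⁻ (there p) (there q) = there (∈-─⁻ p q)

  ∈-─⁺ : ∀ {x y : A} {xs} (p : x ∈ xs) → y ∈ xs → y ≢ x → y ∈ xs ─ p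
  ∈-─⁺ (here refl) (here refl) y≢x = ⊥-elim (y≢x refl)
  ∈-─⁺ (here refl) (there q)   _   = q
  ∈-─⁺ (there p)   (here eq)   _   = here eq
  ∈-─⁺ (there p)   (there q)   y≢x = there (∈-─⁺ p q y≢x)

  ∉-─ : ∀ {x : A} {xs} (p : x ∈ xs) → Unique xs → x ∉ xs ─ p
  ∉-─ (here refl) (x≢ ∷ _) q           = All.lookup x≢ q refl
  ∉-─ (there p)   (x≢ ∷ _) (here refl) = All.lookup x≢ p refl
  ∉-─ (there p)   (_ ∷ u)  (there q)   = ∉-─ p u q

  Unique-─ : ∀ {x : A} {xs} (p : x ∈ xs) → Unique xs → Unique (xs ─ p)
  Unique-─ (here _)  (_ ∷ u)  = u
  Unique-─ (there p) (x≢ ∷ u) = All.tabulate (λ q → All.lookup x≢ (∈-─⁻ p q)) ∷ Unique-─ p u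

  length-─ : ∀ {x : A} {xs} (p : x ∈ xs) → length xs ≡ suc (length (xs ─ p))
  length-─ {xs = xs} p = length-removeAt′ xs (index p)

  Unique-⊆⇒length≤ : ∀ {xs ys : List A} → Unique xs → xs ⊆ ys → length xs ≤ length ys
  Unique-⊆⇒length≤ {[]}     _        _   = z≤n
  Unique-⊆⇒length≤ {x ∷ xs} (x≢ ∷ u) sub = subst (suc (length xs) ≤_) (sym (length-─ x∈ys))
    (s≤s (Unique-⊆⇒length≤ u λ q → ∈-─⁺ x∈ys (sub (there q)) (λ eq → All.lookup x≢ q (sym eq))))
    where x∈ys = sub (here refl)

  nonempty-element : ∀ {xs : List A} → xs ≢ [] → Σ A (_∈ xs)
  nonempty-element {[]}    xs≢[] = ⊥-elim (xs≢[] refl)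
  nonempty-element {x ∷ _} _     = x , here refl

  segment : (ℕ → A) → ℕ → ℕ → List A
  segment z a k = applyUpTo (λ i → z (a + i)) k

  ∈-segment⁺ : ∀ z {a k p} → a ≤ p → p < a + k → z p ∈ segment z a k
  ∈-segment⁺ z {a} a≤p p<a+k = subst (λ q → z q ∈ segment z a _) (m+[n∸m]≡n a≤p)
    (∈-applyUpTo⁺ (λ i → z (a + i)) (+-cancelˡ-< a _ _ (subst (_< a + _) (sym (m+[n∸m]≡n a≤p)) p<a+k)))

  ∈-segment⁻ : ∀ z {a k u} → u ∈ segment z a k → Σ ℕ λ p → a ≤ p × p < a + k × z p ≡ u
  ∈-segment⁻ z {a} q with ∈-applyUpTo⁻ (λ i → z (a + i)) q
  ... | i , i<k , refl = a + i , m≤m+n a i , +-monoʳ-< a i<k , refl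

  Unique-segment : ∀ z a k → (∀ {p q} → p < a + k → q < a + k → z p ≡ z q → p ≡ q) → Unique (segment z a k)
  Unique-segment z a k injective = applyUpTo⁺₁ (λ i → z (a + i)) k
    λ i<j j<k eq → <-irrefl (+-cancelˡ-≡ a _ _ (injective (+-monoʳ-< a (<-trans i<j j<k)) (+-monoʳ-< a j<k) eq)) i<j

-- Walks of north and east steps

monotone-from-suc : (f : ℕ → ℕ) → (∀ j → f j ≤ f (suc j)) → ∀ {p q} → p ≤ q → f p ≤ f q
monotone-from-suc f f-suc {p} {q} p≤q with m≤n⇒m<n∨m≡n p≤q
... | inj₂ refl = ≤-refl
... | inj₁ (s≤s {n = q′} p≤q′) = ≤-trans (monotone-from-suc f f-suc p≤q′) (f-suc q′)

i≤j⇒j≡i+k : ∀ {i j : ℤ} → i ℤ.≤ j → Σ ℕ λ k → j ≡ i ℤ.+ + k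
i≤j⇒j≡i+k {i} {j} i≤j = ℤ.∣ j ℤ.- i ∣ , sym (trans (cong (λ t → i ℤ.+ t) (ℤP.0≤i⇒+∣i∣≡i 0≤j-i)) (i+[j-i]≡j i j))
  where
  0≤j-i : + 0 ℤ.≤ j ℤ.- i
  0≤j-i = subst (ℤ._≤ j ℤ.- i) (ℤP.+-inverseʳ i) (ℤP.+-monoˡ-≤ (ℤ.- i) i≤j)
  i+[j-i]≡j : ∀ i j → i ℤ.+ (j ℤ.- i) ≡ j
  i+[j-i]≡j = solve-∀

i-m≡i-n+k⇒n≡m+k : ∀ (i : ℤ) m n k → i ℤ.- + m ≡ (i ℤ.- + n) ℤ.+ + k → n ≡ m + k
i-m≡i-n+k⇒n≡m+k i m n k eq = ℤP.+-injective (begin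
  + n                                  ≡⟨ lhs i (+ n) (+ k) ⟨
  (i ℤ.- ((i ℤ.- + n) ℤ.+ + k)) ℤ.+ + k ≡⟨ cong (λ t → (i ℤ.- t) ℤ.+ + k) eq ⟨
  (i ℤ.- (i ℤ.- + m)) ℤ.+ + k          ≡⟨ rhs i (+ m) (+ k) ⟩
  + m ℤ.+ + k                          ∎)
  where
  open ≡-Reasoning
  lhs : ∀ i n k → (i ℤ.- ((i ℤ.- n) ℤ.+ k)) ℤ.+ k ≡ n
  lhs = solve-∀
  rhs : ∀ i m k → (i ℤ.- (i ℤ.- m)) ℤ.+ k ≡ m ℤ.+ k
  rhs = solve-∀

i+m≡i+n+k⇒m≡n+k : ∀ (i : ℤ) m n k → i ℤ.+ + m ≡ (i ℤ.+ + n) ℤ.+ + k → m ≡ n + k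
i+m≡i+n+k⇒m≡n+k i m n k eq = ℤP.+-injective (begin
  + m                        ≡⟨ lhs i (+ m) ⟨
  (i ℤ.+ + m) ℤ.- i          ≡⟨ cong (ℤ._- i) eq ⟩
  ((i ℤ.+ + n) ℤ.+ + k) ℤ.- i ≡⟨ rhs i (+ n) (+ k) ⟩
  + n ℤ.+ + k                ∎)
  where
  open ≡-Reasoning
  lhs : ∀ i m → (i ℤ.+ m) ℤ.- i ≡ m
  lhs = solve-∀
  rhs : ∀ i n k → ((i ℤ.+ n) ℤ.+ k) ℤ.- i ≡ n ℤ.+ k
  rhs = solve-∀

_≟ₙ_ : (u v : Node) → Dec (u ≡ v)
_≟ₙ_ = Product.≡-dec ℤP._≟_ ℤP._≟_

open import Data.List.Membership.DecPropositional _≟ₙ_ using (_∈?_)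

N≢E : ∀ u → N u ≢ E u
N≢E (i , j) eq with i-m≡i-n+k⇒n≡m+k i 1 0 0 (trans (cong proj₁ eq) (sym (trans (ℤP.+-identityʳ _) (ℤP.+-identityʳ i))))
... | ()

↘-refl : ∀ u → u ↘ u
↘-refl (i , j) = 0 , 0 , cong₂ _,_ (sym (ℤP.+-identityʳ i)) (sym (ℤP.+-identityʳ j))

N↘ : ∀ u → N u ↘ u
N↘ (i , j) = 1 , 0 , cong₂ _,_ (sym (cancel i)) (sym (ℤP.+-identityʳ j))
  where cancel : ∀ i → (i ℤ.- + 1) ℤ.+ + 1 ≡ i
        cancel = solve-∀

↘E : ∀ u → u ↘ E u
↘E (i , j) = 0 , 1 , cong₂ _,_ (sym (ℤP.+-identityʳ i)) refl

NEWalk : (ℕ → Node) → ℕ → Set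
NEWalk z n = ∀ j → suc j < n → (z (suc j) ≡ N (z j)) ⊎ (z (suc j) ≡ E (z j))

-- a j and c j count the north and the east steps among the first j steps.
module NEWalkCoordinates (z : ℕ → Node) (n : ℕ) (walk : NEWalk z n) where

  counts : ℕ → ℕ × ℕ
  counts zero = 0 , 0
  counts (suc j) with z (suc j) ≟ₙ N (z j) | counts j
  ... | yes _ | (x , y) = suc x , y
  ... | no _  | (x , y) = x , suc y

  a c : ℕ → ℕ
  a j = proj₁ (counts j)
  c j = proj₂ (counts j)

  NorthStep EastStep : ℕ → Set
  NorthStep j = a (suc j) ≡ suc (a j) × c (suc j) ≡ c j
  EastStep j = a (suc j) ≡ a j × c (suc j) ≡ suc (c j)

  step-N : ∀ j → z (suc j) ≡ N (z j) → NorthStep j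
  step-N j eq with z (suc j) ≟ₙ N (z j)
  ... | yes _ = refl , refl
  ... | no ne = ⊥-elim (ne eq)

  step-E : ∀ j → z (suc j) ≡ E (z j) → EastStep j
  step-E j eq with z (suc j) ≟ₙ N (z j)
  ... | yes eq′ = ⊥-elim (N≢E (z j) (trans (sym eq′) eq))
  ... | no _ = refl , refl

  north-or-east : ∀ j → NorthStep j ⊎ EastStep j
  north-or-east j with z (suc j) ≟ₙ N (z j)
  ... | yes _ = inj₁ (refl , refl)
  ... | no _  = inj₂ (refl , refl)

  a+c≡j : ∀ j → a j + c j ≡ j
  a+c≡j zero = refl
  a+c≡j (suc j) with north-or-east j
  ... | inj₁ (p , q) = trans (cong₂ _+_ p q) (cong suc (a+c≡j j))
  ... | inj₂ (p , q) = trans (cong₂ _+_ p q) (trans (+-suc (a j) (c j)) (cong suc (a+c≡j j)))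

  a-suc : ∀ j → a j ≤ a (suc j)
  a-suc j with north-or-east j
  ... | inj₁ (p , _) = ≤-trans (n≤1+n _) (≤-reflexive (sym p))
  ... | inj₂ (p , _) = ≤-reflexive (sym p)

  c-suc : ∀ j → c j ≤ c (suc j)
  c-suc j with north-or-east j
  ... | inj₁ (_ , q) = ≤-reflexive (sym q)
  ... | inj₂ (_ , q) = ≤-trans (n≤1+n _) (≤-reflexive (sym q))

  a-mono : ∀ {p q} → p ≤ q → a p ≤ a q
  a-mono = monotone-from-suc a a-suc

  c-mono : ∀ {p q} → p ≤ q → c p ≤ c q
  c-mono = monotone-from-suc c c-suc

  r₀ c₀ : ℤ
  r₀ = row (z 0)
  c₀ = col (z 0)

  coordinates : ∀ j → j < n → z j ≡ (r₀ ℤ.- + a j , c₀ ℤ.+ + c j)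
  coordinates zero _ = cong₂ _,_ (sym (ℤP.+-identityʳ r₀)) (sym (ℤP.+-identityʳ c₀))
  coordinates (suc j) sj<n with walk j sj<n
  ... | inj₁ north = trans north (trans (cong N (coordinates j (<-trans (n<1+n j) sj<n)))
          (cong₂ _,_ (trans (up r₀ (+ a j)) (cong (λ t → r₀ ℤ.- + t) (sym (proj₁ (step-N j north)))))
                     (cong (λ t → c₀ ℤ.+ + t) (sym (proj₂ (step-N j north))))))
    where
    up : ∀ r x → (r ℤ.- x) ℤ.- + 1 ≡ r ℤ.- (+ 1 ℤ.+ x)
    up = solve-∀
  ... | inj₂ east = trans east (trans (cong E (coordinates j (<-trans (n<1+n j) sj<n)))
          (cong₂ _,_ (cong (λ t → r₀ ℤ.- + t) (sym (proj₁ (step-E j east))))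
                     (trans (right c₀ (+ c j)) (cong (λ t → c₀ ℤ.+ + t) (sym (proj₂ (step-E j east)))))))
    where
    right : ∀ r x → (r ℤ.+ x) ℤ.+ + 1 ≡ r ℤ.+ (+ 1 ℤ.+ x)
    right = solve-∀

  ↘⇒ : ∀ {p q} → p < n → q < n → z p ↘ z q → a q ≤ a p × c p ≤ c q
  ↘⇒ {p} {q} p<n q<n (k , l , eq) =
      subst (a q ≤_) (sym (i-m≡i-n+k⇒n≡m+k r₀ (a q) (a p) k (cong proj₁ eq′))) (m≤m+n _ _) ,
      subst (c p ≤_) (sym (i+m≡i+n+k⇒m≡n+k c₀ (c q) (c p) l (cong proj₂ eq′))) (m≤m+n _ _)
    where
    eq′ : (r₀ ℤ.- + a q , c₀ ℤ.+ + c q) ≡ ((r₀ ℤ.- + a p) ℤ.+ + k , (c₀ ℤ.+ + c p) ℤ.+ + l)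
    eq′ = trans (sym (coordinates q q<n)) (trans eq (cong (λ u → (row u ℤ.+ + k , col u ℤ.+ + l)) (coordinates p p<n)))

  ⇒↗ : ∀ {p q} → p < n → q < n → p ≤ q → z p ↗ z q
  ⇒↗ {p} {q} p<n q<n p≤q = a q ∸ a p , c q ∸ c p ,
    trans (coordinates q q<n) (sym (trans (cong (λ u → (row u ℤ.- + (a q ∸ a p) , col u ℤ.+ + (c q ∸ c p))) (coordinates p p<n))
      (cong₂ _,_ (trans (row-shift r₀ (+ a p) (+ (a q ∸ a p))) (cong (λ t → r₀ ℤ.- + t) (m+[n∸m]≡n (a-mono p≤q))))
                 (trans (col-shift c₀ (+ c p) (+ (c q ∸ c p))) (cong (λ t → c₀ ℤ.+ + t) (m+[n∸m]≡n (c-mono p≤q)))))))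
    where
    row-shift : ∀ r x k → (r ℤ.- x) ℤ.- k ≡ r ℤ.- (x ℤ.+ k)
    row-shift = solve-∀
    col-shift : ∀ r y l → (r ℤ.+ y) ℤ.+ l ≡ r ℤ.+ (y ℤ.+ l)
    col-shift = solve-∀

  counts-injective : ∀ {p q} → a p ≡ a q → c p ≡ c q → p ≡ q
  counts-injective {p} {q} ea ec = trans (sym (a+c≡j p)) (trans (cong₂ _+_ ea ec) (a+c≡j q))

  injective : ∀ {p q} → p < n → q < n → z p ≡ z q → p ≡ q
  injective p<n q<n eq = counts-injective (≤-antisym (proj₁ q↘p) (proj₁ p↘q)) (≤-antisym (proj₂ p↘q) (proj₂ q↘p))
    where
    p↘q = ↘⇒ p<n q<n (subst (z _ ↘_) eq (↘-refl (z _)))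
    q↘p = ↘⇒ q<n p<n (subst (z _ ↘_) (sym eq) (↘-refl (z _)))

  ↘-between-lower : ∀ {p q i} → p < n → i < n → q < n → z p ↘ z i → z i ↘ z q → i < p → i < q → ⊥
  ↘-between-lower {p} {q} {i} p<n i<n q<n p↘i i↘q i<p i<q = contradiction (≤-total p q)
    where
    ai≤ap = proj₁ (↘⇒ p<n i<n p↘i)
    ci≤cq = proj₂ (↘⇒ i<n q<n i↘q)
    ci≡cp = ≤-antisym (c-mono (<⇒≤ i<p)) (proj₂ (↘⇒ p<n i<n p↘i))
    ai≡aq = ≤-antisym (a-mono (<⇒≤ i<q)) (proj₁ (↘⇒ i<n q<n i↘q))
    contradiction : p ≤ q ⊎ q ≤ p → ⊥
    contradiction (inj₁ p≤q) =
      <-irrefl (counts-injective (≤-antisym ai≤ap (≤-trans (a-mono p≤q) (≤-reflexive (sym ai≡aq)))) ci≡cp) i<p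
    contradiction (inj₂ q≤p) =
      <-irrefl (counts-injective ai≡aq (≤-antisym ci≤cq (≤-trans (c-mono q≤p) (≤-reflexive (sym ci≡cp))))) i<q

  ↘-between-upper : ∀ {p q i} → p < n → i < n → q < n → z p ↘ z i → z i ↘ z q → p < i → q < i → ⊥
  ↘-between-upper {p} {q} {i} p<n i<n q<n p↘i i↘q p<i q<i = contradiction (≤-total p q)
    where
    cp≤ci = proj₂ (↘⇒ p<n i<n p↘i)
    aq≤ai = proj₁ (↘⇒ i<n q<n i↘q)
    ai≡ap = ≤-antisym (proj₁ (↘⇒ p<n i<n p↘i)) (a-mono (<⇒≤ p<i))
    ci≡cq = ≤-antisym (proj₂ (↘⇒ i<n q<n i↘q)) (c-mono (<⇒≤ q<i))
    contradiction : p ≤ q ⊎ q ≤ p → ⊥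
    contradiction (inj₁ p≤q) =
      <-irrefl (sym (counts-injective (≤-antisym (≤-trans (≤-reflexive ai≡ap) (a-mono p≤q)) aq≤ai) ci≡cq)) q<i
    contradiction (inj₂ q≤p) =
      <-irrefl (sym (counts-injective ai≡ap (≤-antisym (≤-trans (≤-reflexive ci≡cq) (c-mono q≤p)) cp≤ci))) p<i

-- Ribbons

i-1≤1+i : ∀ i → i ℤ.- + 1 ℤ.≤ + 1 ℤ.+ i
i-1≤1+i i = ℤP.≤-trans (ℤP.i≤j⇒i-k≤j {i} (+ 1) ℤP.≤-refl) (ℤP.i≤suc[i] i)

diag-Adjacent : ∀ u w → Adjacent u w → diag w ℤ.≤ + 1 ℤ.+ diag u
diag-Adjacent (i , j) _ (inj₁ refl) = ℤP.≤-reflexive (north i j)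
  where north : ∀ i j → j ℤ.- (i ℤ.- + 1) ≡ + 1 ℤ.+ (j ℤ.- i)
        north = solve-∀
diag-Adjacent (i , j) _ (inj₂ (inj₁ refl)) = ℤP.≤-reflexive (east i j)
  where east : ∀ i j → (j ℤ.+ + 1) ℤ.- i ≡ + 1 ℤ.+ (j ℤ.- i)
        east = solve-∀
diag-Adjacent (i , j) _ (inj₂ (inj₂ (inj₁ refl))) = ℤP.≤-trans (ℤP.≤-reflexive (south i j)) (i-1≤1+i (j ℤ.- i))
  where south : ∀ i j → j ℤ.- (i ℤ.+ + 1) ≡ (j ℤ.- i) ℤ.- + 1
        south = solve-∀
diag-Adjacent (i , j) _ (inj₂ (inj₂ (inj₂ refl))) = ℤP.≤-trans (ℤP.≤-reflexive (west i j)) (i-1≤1+i (j ℤ.- i))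
  where west : ∀ i j → (j ℤ.- + 1) ℤ.- i ≡ (j ℤ.- i) ℤ.- + 1
        west = solve-∀

-- Diagonals increase by at most one per step, so a path meets every diagonal in between.
Path-meets-diagonals : ∀ {τ u v} → Path τ u v → ∀ d → diag u ℤ.≤ d → d ℤ.≤ diag v → Σ Node λ w → w ∈ τ × diag w ≡ d
Path-meets-diagonals {u = u} (here u∈τ) d u≤d d≤v = u , u∈τ , ℤP.≤-antisym u≤d d≤v
Path-meets-diagonals {u = u} (step {w = w} u∈τ adj path) d u≤d d≤v with diag u ℤP.≟ d
... | yes eq = u , u∈τ , eq
... | no ne  = Path-meets-diagonals path d (ℤP.≤-trans (diag-Adjacent u w adj) (ℤP.i<j⇒suc[i]≤j (ℤP.≤∧≢⇒< u≤d ne))) d≤v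

module _ {ν : Shape} (skew : IsSkew ν) (thin : Thin ν) where

  next-diagonal-same-row : ∀ {i j j′} → j′ ℤ.- i ≡ (j ℤ.- i) ℤ.+ + 1 → (i , j′) ≡ E (i , j)
  next-diagonal-same-row {i} {j} {j′} dg = cong (i ,_) (begin
    j′                              ≡⟨ cancel i j′ ⟨
    (j′ ℤ.- i) ℤ.+ i                ≡⟨ cong (ℤ._+ i) dg ⟩
    ((j ℤ.- i) ℤ.+ + 1) ℤ.+ i     ≡⟨ shift i j ⟩
    j ℤ.+ + 1                     ∎)
    where
    open ≡-Reasoning
    cancel : ∀ i j′ → (j′ ℤ.- i) ℤ.+ i ≡ j′
    cancel = solve-∀
    shift : ∀ i j → ((j ℤ.- i) ℤ.+ + 1) ℤ.+ i ≡ j ℤ.+ + 1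
    shift = solve-∀

  next-diagonal-not-below : ∀ {i j i′ j′} → (i , j) ∈ ν → (i′ , j′) ∈ ν →
    j′ ℤ.- i′ ≡ (j ℤ.- i) ℤ.+ + 1 → ¬ i ℤ.< i′
  next-diagonal-not-below {i} {j} {i′} {j′} u∈ν w∈ν dg i<i′ = ℤP.<-irrefl (cong proj₁ v≡w) i<i′
    where
    k = proj₁ (i≤j⇒j≡i+k (ℤP.<⇒≤ i<i′))
    i′≡i+k = proj₂ (i≤j⇒j≡i+k (ℤP.<⇒≤ i<i′))
    v = (i , j ℤ.+ + 1)
    j′≡j+1+k : j′ ≡ (j ℤ.+ + 1) ℤ.+ + k
    j′≡j+1+k = trans (sym (cancel i′ j′)) (trans (cong (ℤ._+ i′) dg) (trans (cong (λ t → ((j ℤ.- i) ℤ.+ + 1) ℤ.+ t) i′≡i+k) (shift i j (+ k))))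
      where cancel : ∀ i j′ → (j′ ℤ.- i) ℤ.+ i ≡ j′
            cancel = solve-∀
            shift : ∀ i j k → ((j ℤ.- i) ℤ.+ + 1) ℤ.+ (i ℤ.+ k) ≡ (j ℤ.+ + 1) ℤ.+ k
            shift = solve-∀
    v∈ν : v ∈ ν
    v∈ν = skew (i , j) v (i′ , j′) u∈ν w∈ν (0 , 1 , cong₂ _,_ (sym (ℤP.+-identityʳ i)) refl) (k , k , cong₂ _,_ i′≡i+k j′≡j+1+k)
    v≡w : v ≡ (i′ , j′)
    v≡w = thin v (i′ , j′) v∈ν w∈ν (trans (rearrange i j) (sym dg))
      where rearrange : ∀ i j → (j ℤ.+ + 1) ℤ.- i ≡ (j ℤ.- i) ℤ.+ + 1
            rearrange = solve-∀

  next-diagonal-above : ∀ {i j i′ j′} → (i , j) ∈ ν → (i′ , j′) ∈ ν →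
    j′ ℤ.- i′ ≡ (j ℤ.- i) ℤ.+ + 1 → i′ ℤ.< i → (i′ , j′) ≡ N (i , j)
  next-diagonal-above {i} {j} {i′} {j′} u∈ν w∈ν dg i′<i with i≤j⇒j≡i+k (ℤP.i<j⇒suc[i]≤j i′<i)
  ... | zero , i≡1+i′ = cong₂ _,_ i′≡i-1 j′≡j
    where
    i′≡i-1 : i′ ≡ i ℤ.- + 1
    i′≡i-1 = trans (sym (cancel i′)) (cong (ℤ._- + 1) (trans (sym (ℤP.+-identityʳ (+ 1 ℤ.+ i′))) (sym i≡1+i′)))
      where cancel : ∀ i′ → (+ 1 ℤ.+ i′) ℤ.- + 1 ≡ i′
            cancel = solve-∀
    j′≡j : j′ ≡ j
    j′≡j = trans (sym (cancel i′ j′)) (trans (cong (ℤ._+ i′) dg)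
             (trans (cong (λ t → ((j ℤ.- t) ℤ.+ + 1) ℤ.+ i′) (trans i≡1+i′ (ℤP.+-identityʳ _))) (shift i′ j)))
      where cancel : ∀ i j′ → (j′ ℤ.- i) ℤ.+ i ≡ j′
            cancel = solve-∀
            shift : ∀ i′ j → ((j ℤ.- (+ 1 ℤ.+ i′)) ℤ.+ + 1) ℤ.+ i′ ≡ j
            shift = solve-∀
  ... | suc k′ , i≡1+i′+k = ⊥-elim (no-shift (trans (cong proj₁ v≡u) i≡1+i′+k))
    where
    k = suc k′
    v = (+ 1 ℤ.+ i′ , j′)
    no-shift : ℤ.+ 1 ℤ.+ i′ ≢ (+ 1 ℤ.+ i′) ℤ.+ + k
    no-shift eq with i+m≡i+n+k⇒m≡n+k (+ 1 ℤ.+ i′) 0 0 k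
      (trans (ℤP.+-identityʳ (+ 1 ℤ.+ i′)) (trans eq (cong (ℤ._+ + k) (sym (ℤP.+-identityʳ (+ 1 ℤ.+ i′))))))
    ... | ()
    j≡j′+k : j ≡ j′ ℤ.+ + k
    j≡j′+k = trans (expand i j) (trans (cong (λ t → (t ℤ.+ i) ℤ.- + 1) (sym dg))
               (trans (cong (λ t → ((j′ ℤ.- i′) ℤ.+ t) ℤ.- + 1) i≡1+i′+k) (shift i′ j′ (+ k))))
      where expand : ∀ i j → j ≡ (((j ℤ.- i) ℤ.+ + 1) ℤ.+ i) ℤ.- + 1
            expand = solve-∀
            shift : ∀ i′ j′ k → ((j′ ℤ.- i′) ℤ.+ ((+ 1 ℤ.+ i′) ℤ.+ k)) ℤ.- + 1 ≡ j′ ℤ.+ k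
            shift = solve-∀
    v∈ν : v ∈ ν
    v∈ν = skew (i′ , j′) v (i , j) w∈ν u∈ν (1 , 0 , cong₂ _,_ (ℤP.+-comm (+ 1) i′) (sym (ℤP.+-identityʳ j′)))
               (k , k , cong₂ _,_ i≡1+i′+k j≡j′+k)
    v≡u : v ≡ (i , j)
    v≡u = thin v (i , j) v∈ν u∈ν (trans (rearrange i′ j′) (trans (cong (ℤ._- + 1) dg) (cancel i j)))
      where rearrange : ∀ i′ j′ → j′ ℤ.- (+ 1 ℤ.+ i′) ≡ (j′ ℤ.- i′) ℤ.- + 1
            rearrange = solve-∀
            cancel : ∀ i j → ((j ℤ.- i) ℤ.+ + 1) ℤ.- + 1 ≡ j ℤ.- i
            cancel = solve-∀

  next-diagonal : ∀ {u w} → u ∈ ν → w ∈ ν → diag w ≡ diag u ℤ.+ + 1 → w ≡ N u ⊎ w ≡ E u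
  next-diagonal {i , j} {i′ , j′} u∈ν w∈ν dg with ℤP.<-cmp i i′
  ... | tri< i<i′ _ _ = ⊥-elim (next-diagonal-not-below u∈ν w∈ν dg i<i′)
  ... | tri≈ _ refl _ = inj₂ (next-diagonal-same-row {j = j} dg)
  ... | tri> _ _ i′<i = inj₁ (next-diagonal-above u∈ν w∈ν dg i′<i)

record NEWalkThrough (ν : Shape) (b : Node) (z : ℕ → Node) (n : ℕ) : Set where
  field
    walk    : NEWalk z n
    starts  : z 0 ≡ b
    members : ∀ u → (u ∈ ν) ⇔ (Σ ℕ λ j → j < n × z j ≡ u)

minimal-diagonal : ∀ τ → τ ≢ [] → Σ Node λ m → m ∈ τ × (∀ {u} → u ∈ τ → diag m ℤ.≤ diag u)
minimal-diagonal []       τ≢[] = ⊥-elim (τ≢[] refl)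
minimal-diagonal (x ∷ xs) _    = m , m∈ , minimal
  where
  m = Extrema.argmin diag x xs
  m∈ : m ∈ x ∷ xs
  m∈ with Extrema.argmin-sel diag x xs
  ... | inj₁ m≡x  = here m≡x
  ... | inj₂ m∈xs = there m∈xs
  minimal : ∀ {u} → u ∈ x ∷ xs → diag m ℤ.≤ diag u
  minimal (here refl) = Extrema.f[argmin]≤f[⊤] {f = diag} x xs
  minimal (there u∈)  = All.lookup (Extrema.f[argmin]≤f[xs] {f = diag} x xs) u∈

-- A ribbon meets each diagonal between its extreme ones exactly once; listed from the
-- south-west, these nodes form a walk of north and east steps.
module RibbonWalk (ν : Shape) (ribbon : Ribbon ν) where

  private
    skew  = proj₂ (proj₁ ribbon)
    thin  = proj₁ (proj₂ (proj₂ ribbon))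
    connected = proj₂ (proj₂ (proj₂ ribbon))

  n : ℕ
  n = length ν

  m : Node
  m = proj₁ (minimal-diagonal ν (proj₁ (proj₂ ribbon)))

  m∈ν : m ∈ ν
  m∈ν = proj₁ (proj₂ (minimal-diagonal ν (proj₁ (proj₂ ribbon))))

  offset : Node → ℕ
  offset u = ℤ.∣ diag u ℤ.- diag m ∣

  offset-diag : ∀ {u} → u ∈ ν → diag u ≡ diag m ℤ.+ + offset u
  offset-diag u∈ν = proj₂ (i≤j⇒j≡i+k (proj₂ (proj₂ (minimal-diagonal ν (proj₁ (proj₂ ribbon)))) u∈ν))

  Occupied : ℕ → Set
  Occupied j = Σ Node λ w → w ∈ ν × diag w ≡ diag m ℤ.+ + j

  z : ℕ → Node
  z j with any? (λ u → diag u ℤP.≟ diag m ℤ.+ + j) ν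
  ... | yes found = proj₁ (find found)
  ... | no _      = m

  z-unique : ∀ j {w} → w ∈ ν → diag w ≡ diag m ℤ.+ + j → z j ≡ w
  z-unique j w∈ν dw with any? (λ u → diag u ℤP.≟ diag m ℤ.+ + j) ν
  ... | yes found = thin _ _ (proj₁ (proj₂ (find found))) w∈ν (trans (proj₂ (proj₂ (find found))) (sym dw))
  ... | no none   = ⊥-elim (none (lose w∈ν dw))

  z-occupied : ∀ {j} → Occupied j → z j ∈ ν × diag (z j) ≡ diag m ℤ.+ + j
  z-occupied {j} (w , w∈ν , dw) = subst (_∈ ν) (sym z≡w) w∈ν , trans (cong diag z≡w) dw
    where z≡w = z-unique j w∈ν dw

  z-offset : ∀ {u} → u ∈ ν → z (offset u) ≡ u
  z-offset u∈ν = z-unique _ u∈ν (offset-diag u∈ν)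

  occupied-below : ∀ {u j} → u ∈ ν → j ≤ offset u → Occupied j
  occupied-below {u} {j} u∈ν j≤ = Path-meets-diagonals (connected m u m∈ν u∈ν) (diag m ℤ.+ + j)
    (ℤP.i≤i+j (diag m) (+ j))
    (subst (diag m ℤ.+ + j ℤ.≤_) (sym (offset-diag u∈ν)) (ℤP.+-monoʳ-≤ (diag m) (ℤ.+≤+ j≤)))

  z-injective : ∀ {p q} → Occupied p → Occupied q → z p ≡ z q → p ≡ q
  z-injective {p} {q} occ-p occ-q eq = trans (i+m≡i+n+k⇒m≡n+k (diag m) p q 0 (begin
    diag m ℤ.+ + p              ≡⟨ proj₂ (z-occupied occ-p) ⟨
    diag (z p)                    ≡⟨ cong diag eq ⟩
    diag (z q)                    ≡⟨ proj₂ (z-occupied occ-q) ⟩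
    diag m ℤ.+ + q              ≡⟨ ℤP.+-identityʳ _ ⟨
    (diag m ℤ.+ + q) ℤ.+ + 0  ∎)) (+-identityʳ q)
    where open ≡-Reasoning

  offset<n : ∀ {u} → u ∈ ν → offset u < n
  offset<n {u} u∈ν with offset u <? n
  ... | yes lt = lt
  ... | no ¬lt = ⊥-elim (<-irrefl refl (subst (_≤ n) (length-applyUpTo (λ i → z (0 + i)) (suc n))
                   (Unique-⊆⇒length≤ (Unique-segment z 0 (suc n) injective) ⊆ν)))
    where
    occupied : ∀ {j} → j < suc n → Occupied j
    occupied j<1+n = occupied-below u∈ν (≤-trans (ℕ.s≤s⁻¹ j<1+n) (≮⇒≥ ¬lt))
    injective : ∀ {p q} → p < suc n → q < suc n → z p ≡ z q → p ≡ q
    injective p< q< = z-injective (occupied p<) (occupied q<)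
    ⊆ν : segment z 0 (suc n) ⊆ ν
    ⊆ν w∈ with ∈-segment⁻ z w∈
    ... | _ , _ , j< , refl = proj₁ (z-occupied (occupied j<))

  occupied : ∀ {j} → j < n → Occupied j
  occupied {j} j<n with any? (λ u → diag u ℤP.≟ diag m ℤ.+ + j) ν
  ... | yes found = find found
  ... | no none   = ⊥-elim (<-irrefl refl (<-≤-trans j<n (subst (n ≤_) (length-applyUpTo (λ i → z (0 + i)) j)
                      (Unique-⊆⇒length≤ (proj₁ (proj₁ ribbon)) ν⊆))))
    where
    offset<j : ∀ {u} → u ∈ ν → offset u < j
    offset<j {u} u∈ν with offset u <? j
    ... | yes lt = lt
    ... | no ¬lt = ⊥-elim (none (lose (proj₁ (proj₂ occ)) (proj₂ (proj₂ occ))))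
      where occ = occupied-below u∈ν (≮⇒≥ ¬lt)
    ν⊆ : ν ⊆ segment z 0 j
    ν⊆ u∈ν = subst (_∈ segment z 0 j) (z-offset u∈ν) (∈-segment⁺ z z≤n (offset<j u∈ν))

  walk : NEWalk z n
  walk j 1+j<n = next-diagonal skew thin (proj₁ (z-occupied (occupied j<n))) (proj₁ (z-occupied (occupied 1+j<n)))
    (trans (proj₂ (z-occupied (occupied 1+j<n)))
      (trans (cong (λ k → diag m ℤ.+ + k) (+-comm 1 j))
        (trans (sym (ℤP.+-assoc (diag m) (+ j) (+ 1))) (cong (ℤ._+ + 1) (sym (proj₂ (z-occupied (occupied j<n))))))))
    where j<n = <-trans (n<1+n j) 1+j<n

  open NEWalkCoordinates z n walk using (⇒↗)

  through : ∀ {b} → IsSW ν b → NEWalkThrough ν b z n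
  through {b} (b∈ν , b-SW) = record
    { walk    = walk
    ; starts  = trans z0≡m (b-SW m m∈ν (subst (_↗ b) z0≡m (subst (z 0 ↗_) (z-offset b∈ν) (⇒↗ 0<n (offset<n b∈ν) z≤n))))
    ; members = λ u → mk⇔ (λ u∈ν → offset u , offset<n u∈ν , z-offset u∈ν)
                         (λ { (j , j<n , refl) → proj₁ (z-occupied (occupied j<n)) })
    }
    where
    z0≡m = z-unique 0 m∈ν (sym (ℤP.+-identityʳ (diag m)))
    0<n = ≤-<-trans z≤n (offset<n m∈ν)

-- The root lattice

sum-zipWith-+ : ∀ {n} (x y : Vec ℕ n) → Vec.sum (zipWith _+_ x y) ≡ Vec.sum x + Vec.sum y
sum-zipWith-+ [] [] = refl
sum-zipWith-+ (a ∷ x) (b ∷ y) = trans (cong (λ s → a + b + s) (sum-zipWith-+ x y)) (interchange a b (Vec.sum x) (Vec.sum y))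

sum-replicate : ∀ n m → Vec.sum (replicate n m) ≡ n ℕ.* m
sum-replicate zero    m = refl
sum-replicate (suc n) m = cong (λ s → m + s) (sum-replicate n m)

sum-indicator : ∀ n k → k < n → Vec.sum (tabulate {n = n} (λ s → if toℕ s ≡ᵇ k then 1 else 0)) ≡ 1
sum-indicator (suc n) zero    _         = cong suc (trans (cong Vec.sum (tabulate-0 n)) (trans (sum-replicate n 0) (*-zeroʳ n)))
  where
  tabulate-0 : ∀ n → tabulate {n = n} (λ s → if suc (toℕ s) ≡ᵇ 0 then 1 else 0) ≡ replicate n 0
  tabulate-0 zero    = refl
  tabulate-0 (suc n) = cong (0 ∷_) (tabulate-0 n)
sum-indicator (suc n) (suc k) (s≤s k<n) = sum-indicator n k k<n

lookup-ext : ∀ {A : Set} {n} (xs ys : Vec A n) → (∀ i → lookup xs i ≡ lookup ys i) → xs ≡ ys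
lookup-ext xs ys eq = trans (sym (tabulate∘lookup xs)) (trans (tabulate-cong eq) (tabulate∘lookup ys))

sum≡0⇒≡replicate0 : ∀ {n} (x : Vec ℕ n) → Vec.sum x ≡ 0 → x ≡ replicate n 0
sum≡0⇒≡replicate0 []      _  = refl
sum≡0⇒≡replicate0 (a ∷ x) eq = cong₂ _∷_ (m+n≡0⇒m≡0 a eq) (sum≡0⇒≡replicate0 x (m+n≡0⇒n≡0 a eq))

zipWith-+-cancelˡ : ∀ {n} (x y z : Vec ℕ n) → zipWith _+_ x y ≡ zipWith _+_ x z → y ≡ z
zipWith-+-cancelˡ [] [] [] _ = refl
zipWith-+-cancelˡ (a ∷ x) (b ∷ y) (c ∷ z) eq =
  cong₂ _∷_ (+-cancelˡ-≡ a b c (cong Vec.head eq)) (zipWith-+-cancelˡ x y z (cong Vec.tail eq))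

module _ (e : ℕ) {{_ : NonZero e}} where

  infixl 6 _⊞_
  _⊞_ : Wt e → Wt e → Wt e
  _⊞_ = _⊕_ e

  ⊞-comm : ∀ x y → x ⊞ y ≡ y ⊞ x
  ⊞-comm = zipWith-comm +-comm

  ⊞-assoc : ∀ x y z → (x ⊞ y) ⊞ z ≡ x ⊞ (y ⊞ z)
  ⊞-assoc = zipWith-assoc +-assoc

  ⊞-identityʳ : ∀ x → x ⊞ zeroW e ≡ x
  ⊞-identityʳ = zipWith-identityʳ +-identityʳ

  ⊞-identityˡ : ∀ x → zeroW e ⊞ x ≡ x
  ⊞-identityˡ x = trans (⊞-comm _ x) (⊞-identityʳ x)

  ⊞-cancelˡ : ∀ x y z → x ⊞ y ≡ x ⊞ z → y ≡ z
  ⊞-cancelˡ = zipWith-+-cancelˡ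

  lookup-⊞ : ∀ x y i → lookup (x ⊞ y) i ≡ lookup x i + lookup y i
  lookup-⊞ x y i = lookup-zipWith _+_ i x y

  lookup-zeroW : ∀ i → lookup (zeroW e) i ≡ 0
  lookup-zeroW i = lookup-replicate i 0

  lookup-mulδ : ∀ m i → lookup (mulδ e m) i ≡ m
  lookup-mulδ m i = lookup-replicate i m

  [_≡_%e] : Fin e → ℕ → ℕ
  [ i ≡ r %e] = if toℕ i ≡ᵇ r % e then 1 else 0

  lookup-unit : ∀ r i → lookup (unit e r) i ≡ [ i ≡ r %e]
  lookup-unit r i = lookup∘tabulate _ i

  [≡%e]-yes : ∀ i r → toℕ i ≡ r % e → [ i ≡ r %e] ≡ 1
  [≡%e]-yes i r eq with toℕ i ≡ᵇ r % e in b
  ... | true  = refl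
  ... | false = ⊥-elim (subst T b (≡⇒≡ᵇ _ _ eq))

  [≡%e]-no : ∀ i r → toℕ i ≢ r % e → [ i ≡ r %e] ≡ 0
  [≡%e]-no i r ne with toℕ i ≡ᵇ r % e in b
  ... | true  = ⊥-elim (ne (≡ᵇ⇒≡ _ _ (subst T (sym b) _)))
  ... | false = refl

  [≡%e]-pos : ∀ i r → 1 ≤ [ i ≡ r %e] → toℕ i ≡ r % e
  [≡%e]-pos i r p with toℕ i ℕ.≟ r % e
  ... | yes q = q
  ... | no q with () ← subst (1 ≤_) ([≡%e]-no i r q) p

  residue : ℕ → Fin e
  residue r = fromℕ< (m%n<n r e)

  toℕ-residue : ∀ r → toℕ (residue r) ≡ r % e
  toℕ-residue r = toℕ-fromℕ< (m%n<n r e)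

  [residue≡%e] : ∀ r → [ residue r ≡ r %e] ≡ 1
  [residue≡%e] r = [≡%e]-yes (residue r) r (toℕ-residue r)

  next prev : Fin e → Fin e
  next i = residue (suc (toℕ i))
  prev i = residue (toℕ i + (e ∸ 1))

  [next≡suc%e] : ∀ i r → [ next i ≡ suc r %e] ≡ [ i ≡ r %e]
  [next≡suc%e] i r with toℕ i ℕ.≟ r % e
  ... | yes q = trans ([≡%e]-yes (next i) (suc r) (trans (toℕ-residue _) (trans (cong (λ x → suc x % e) q) (sym (suc-% e r)))))
                      (sym ([≡%e]-yes i r q))
  ... | no q  = trans ([≡%e]-no (next i) (suc r) λ h → q (suc-%-injective e (toℕ<n i) (m%n<n r e)
                          (trans (sym (toℕ-residue _)) (trans h (suc-% e r)))))
                      (sym ([≡%e]-no i r q))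

  next-prev : ∀ i → next (prev i) ≡ i
  next-prev i = toℕ-injective (begin
    toℕ (next (prev i))                ≡⟨ toℕ-residue _ ⟩
    suc (toℕ (prev i)) % e             ≡⟨ cong (λ x → suc x % e) (toℕ-residue _) ⟩
    suc ((toℕ i + (e ∸ 1)) % e) % e    ≡⟨ suc-% e _ ⟨
    suc (toℕ i + (e ∸ 1)) % e          ≡⟨ cong (_% e) (+-suc (toℕ i) (e ∸ 1)) ⟨
    (toℕ i + suc (e ∸ 1)) % e          ≡⟨ cong (λ x → (toℕ i + x) % e) (suc-pred e) ⟩
    (toℕ i + e) % e                    ≡⟨ [m+n]%n≡m%n (toℕ i) e ⟩
    toℕ i % e                          ≡⟨ m<n⇒m%n≡m (toℕ<n i) ⟩
    toℕ i                              ∎)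
    where open ≡-Reasoning

  lookup-α-suc : ∀ t p i → lookup (α e t (suc p)) i ≡ lookup (α e t p) i + [ i ≡ t + p %e]
  lookup-α-suc t p i = trans (lookup-⊞ (α e t p) (unit e (t + p)) i) (cong (_+_ (lookup (α e t p) i)) (lookup-unit (t + p) i))

  α-+ : ∀ t p q → α e t (p + q) ≡ α e t p ⊞ α e (t + p) q
  α-+ t p zero = trans (cong (α e t) (+-identityʳ p)) (sym (⊞-identityʳ _))
  α-+ t p (suc q) = begin
    α e t (p + suc q)                               ≡⟨ cong (α e t) (+-suc p q) ⟩
    α e t (p + q) ⊞ unit e (t + (p + q))            ≡⟨ cong₂ _⊞_ (α-+ t p q) (cong (unit e) (sym (+-assoc t p q))) ⟩
    (α e t p ⊞ α e (t + p) q) ⊞ unit e (t + p + q)  ≡⟨ ⊞-assoc _ _ _ ⟩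
    α e t p ⊞ α e (t + p) (suc q)                   ∎
    where open ≡-Reasoning

  α-1 : ∀ t → α e t 1 ≡ unit e t
  α-1 t = trans (⊞-identityˡ _) (cong (unit e) (+-identityʳ t))

  α-suc : ∀ t p → α e t (suc p) ≡ unit e t ⊞ α e (suc t) p
  α-suc t p = trans (α-+ t 1 p) (cong₂ _⊞_ (α-1 t) (cong (λ x → α e x p) (+-comm t 1)))

  unit-cong : ∀ {r r′} → r % e ≡ r′ % e → unit e r ≡ unit e r′
  unit-cong eq = cong (λ x → tabulate (λ s → if toℕ s ≡ᵇ x then 1 else 0)) eq

  α-cong : ∀ {t t′} h → t % e ≡ t′ % e → α e t h ≡ α e t′ h
  α-cong zero    eq = refl
  α-cong (suc h) eq = cong₂ _⊞_ (α-cong h eq) (unit-cong (+-%-congˡ e h eq))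

  α-residue : ∀ t h → α e t h ≡ α e (toℕ (residue t)) h
  α-residue t h = α-cong h (sym (trans (cong (_% e) (toℕ-residue t)) (m%n%n≡m%n t e)))

  α-suc-start : ∀ t h → e ∣ h → α e (suc t) h ≡ α e t h
  α-suc-start t h e∣h = ⊞-cancelˡ (unit e t) _ _ (begin
    unit e t ⊞ α e (suc t) h   ≡⟨ α-suc t h ⟨
    α e t (suc h)              ≡⟨ cong (α e t h ⊞_) (unit-cong (%-remove-+ʳ t e∣h)) ⟩
    α e t h ⊞ unit e t         ≡⟨ ⊞-comm _ _ ⟩
    unit e t ⊞ α e t h         ∎)
    where open ≡-Reasoning

  α-start-irrelevant : ∀ t t′ h → e ∣ h → α e t h ≡ α e t′ h
  α-start-irrelevant t t′ h e∣h = trans (from0 t) (sym (from0 t′))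
    where
    from0 : ∀ t → α e t h ≡ α e 0 h
    from0 zero    = refl
    from0 (suc t) = trans (α-suc-start t h e∣h) (from0 t)

  -- Consecutive coefficients of α(t, p) differ only where the string starts or ends.
  α-balance : ∀ i t p → lookup (α e t p) (next i) + [ next i ≡ t + p %e] ≡ lookup (α e t p) i + [ next i ≡ t %e]
  α-balance i t zero = trans (cong₂ _+_ (lookup-zeroW (next i)) (cong [ next i ≡_%e] (+-identityʳ t)))
                              (cong (_+ [ next i ≡ t %e]) (sym (lookup-zeroW i)))
  α-balance i t (suc p) = begin
    lookup (α e t (suc p)) (next i) + [ next i ≡ t + suc p %e]
      ≡⟨ cong₂ _+_ (lookup-α-suc t p (next i)) (trans (cong [ next i ≡_%e] (+-suc t p)) ([next≡suc%e] i (t + p))) ⟩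
    (A + [ next i ≡ t + p %e]) + [ i ≡ t + p %e]
      ≡⟨ cong (_+ [ i ≡ t + p %e]) (α-balance i t p) ⟩
    (B + [ next i ≡ t %e]) + [ i ≡ t + p %e]
      ≡⟨ +-assoc B _ _ ⟩
    B + ([ next i ≡ t %e] + [ i ≡ t + p %e])
      ≡⟨ cong (_+_ B) (+-comm _ [ i ≡ t + p %e]) ⟩
    B + ([ i ≡ t + p %e] + [ next i ≡ t %e])
      ≡⟨ +-assoc B _ _ ⟨
    (B + [ i ≡ t + p %e]) + [ next i ≡ t %e]
      ≡⟨ cong (_+ [ next i ≡ t %e]) (lookup-α-suc t p i) ⟨
    lookup (α e t (suc p)) i + [ next i ≡ t %e] ∎
    where
    open ≡-Reasoning
    A = lookup (α e t p) (next i)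
    B = lookup (α e t p) i

  α-excess : ∀ t h → ¬ (e ∣ h) → lookup (α e t h) (residue t) ≡ suc (lookup (α e t h) (prev (residue t)))
  α-excess t h e∤h = begin
    lookup (α e t h) (residue t)                                    ≡⟨ +-identityʳ _ ⟨
    lookup (α e t h) (residue t) + 0                                ≡⟨ cong (_+_ (lookup (α e t h) (residue t))) (sym end) ⟩
    lookup (α e t h) (residue t) + [ residue t ≡ t + h %e]          ≡⟨ balance ⟩
    lookup (α e t h) (prev (residue t)) + [ residue t ≡ t %e]       ≡⟨ cong (_+_ _) ([residue≡%e] t) ⟩
    lookup (α e t h) (prev (residue t)) + 1                         ≡⟨ +-comm _ 1 ⟩
    suc (lookup (α e t h) (prev (residue t)))                       ∎
    where
    open ≡-Reasoning
    end : [ residue t ≡ t + h %e] ≡ 0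
    end = [≡%e]-no (residue t) (t + h) λ q → e∤h ([t+h]%e≡t%e⇒e∣h e t h (trans (sym q) (toℕ-residue t)))
    balance : lookup (α e t h) (residue t) + [ residue t ≡ t + h %e] ≡ lookup (α e t h) (prev (residue t)) + [ residue t ≡ t %e]
    balance = subst (λ i → lookup (α e t h) i + [ i ≡ t + h %e] ≡ lookup (α e t h) (prev (residue t)) + [ i ≡ t %e])
                    (next-prev (residue t)) (α-balance (prev (residue t)) t h)

  lookup-α-outside : ∀ s h i → (∀ k → k < h → [ i ≡ s + k %e] ≡ 0) → lookup (α e s h) i ≡ 0
  lookup-α-outside s zero    i _   = lookup-zeroW i
  lookup-α-outside s (suc h) i out = trans (lookup-α-suc s h i)
    (cong₂ _+_ (lookup-α-outside s h i (λ k k<h → out k (≤-trans k<h (n≤1+n h)))) (out h ≤-refl))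

  δ≡α0e : δ e ≡ α e 0 e
  δ≡α0e = lookup-ext (δ e) (α e 0 e) λ i → trans (lookup-mulδ 1 i) (sym (coefficient i))
    where
    coefficient : ∀ i → lookup (α e 0 e) i ≡ 1
    coefficient i = begin
      lookup (α e 0 e) i                                        ≡⟨ cong (λ v → lookup v i) (α-start-irrelevant 0 t e ∣-refl) ⟩
      lookup (α e t e) i                                        ≡⟨ cong (λ v → lookup (α e t v) i) (suc-pred e) ⟨
      lookup (α e t (suc (ℕ.pred e))) i                         ≡⟨ cong (λ v → lookup v i) (α-suc t (ℕ.pred e)) ⟩
      lookup (unit e t ⊞ α e (suc t) (ℕ.pred e)) i              ≡⟨ lookup-⊞ (unit e t) _ i ⟩
      lookup (unit e t) i + lookup (α e (suc t) (ℕ.pred e)) i   ≡⟨ cong₂ _+_ (lookup-unit t i) (lookup-α-outside (suc t) (ℕ.pred e) i outside) ⟩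
      [ i ≡ t %e] + 0                                           ≡⟨ cong (_+ 0) ([≡%e]-yes i t (sym (m<n⇒m%n≡m (toℕ<n i)))) ⟩
      1                                                         ∎
      where
      open ≡-Reasoning
      t = toℕ i
      outside : ∀ k → k < ℕ.pred e → [ i ≡ suc t + k %e] ≡ 0
      outside k k<e-1 = [≡%e]-no i (suc t + k) λ q → <-irrefl refl (≤-<-trans (∣⇒≤ (e∣1+k q)) 1+k<e)
        where
        1+k<e = subst (suc k <_) (suc-pred e) (s≤s k<e-1)
        e∣1+k : t ≡ (suc t + k) % e → e ∣ suc k
        e∣1+k q = [t+h]%e≡t%e⇒e∣h e t (suc k)
          (trans (cong (_% e) (+-suc t k)) (trans (sym q) (sym (m<n⇒m%n≡m (toℕ<n i)))))

  ht-⊞ : ∀ x y → ht e (x ⊞ y) ≡ ht e x + ht e y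
  ht-⊞ = sum-zipWith-+

  ht-unit : ∀ r → ht e (unit e r) ≡ 1
  ht-unit r = sum-indicator e (r % e) (m%n<n r e)

  ht-zeroW : ht e (zeroW e) ≡ 0
  ht-zeroW = trans (sum-replicate e 0) (*-zeroʳ e)

  ht-α : ∀ t h → ht e (α e t h) ≡ h
  ht-α t zero    = ht-zeroW
  ht-α t (suc h) = trans (ht-⊞ (α e t h) (unit e (t + h))) (trans (cong₂ _+_ (ht-α t h) (ht-unit (t + h))) (+-comm h 1))

  ht-mulδ : ∀ m → ht e (mulδ e m) ≡ e ℕ.* m
  ht-mulδ = sum-replicate e

  ht-cont : ∀ τ → ht e (cont e τ) ≡ length τ
  ht-cont []      = ht-zeroW
  ht-cont (u ∷ τ) = trans (ht-⊞ (unit e (res e u)) (cont e τ)) (cong₂ _+_ (ht-unit (res e u)) (ht-cont τ))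

  α-PosRoot : ∀ t p → 1 ≤ p → PosRoot e (α e t p)
  α-PosRoot t p p≥1 = residue t , p , p≥1 , α-residue t p

  InΨ⇒PosRoot : ∀ {β} → InΨ e β → PosRoot e β
  InΨ⇒PosRoot (inj₁ (t , h , h≥1 , _ , eq)) = t , h , h≥1 , eq
  InΨ⇒PosRoot (inj₂ refl) = subst (PosRoot e) (sym δ≡α0e) (α-PosRoot 0 e (ℕ.>-nonZero⁻¹ e))

  RealRoot⇒¬ImagRoot : ∀ {β} → RealRoot e β → ¬ ImagRoot e β
  RealRoot⇒¬ImagRoot (t₀ , h , _ , e∤h , refl) (m , _ , eq) = <-irrefl (begin-equality
    lookup (α e t h) (prev i)                      ≡⟨ cong (λ v → lookup v (prev i)) eq ⟩
    lookup (mulδ e m) (prev i)                     ≡⟨ lookup-mulδ m (prev i) ⟩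
    m                                              ∎) (begin-strict
    lookup (α e t h) (prev i)                      <⟨ n<1+n _ ⟩
    suc (lookup (α e t h) (prev i))                ≡⟨ α-excess t h e∤h ⟨
    lookup (α e t h) i                             ≡⟨ cong (λ v → lookup v i) eq ⟩
    lookup (mulδ e m) i                            ≡⟨ lookup-mulδ m i ⟩
    m                                              ∎)
    where
    open ≤-Reasoning
    t = toℕ t₀
    i = residue t

  ht-PosRoot : ∀ {γ} → PosRoot e γ → 1 ≤ ht e γ
  ht-PosRoot (t , p , p≥1 , refl) = subst (1 ≤_) (sym (ht-α (toℕ t) p)) p≥1


  x⊞[y⊞z]≡y⊞[x⊞z] : ∀ x y z → x ⊞ (y ⊞ z) ≡ y ⊞ (x ⊞ z)
  x⊞[y⊞z]≡y⊞[x⊞z] x y z = trans (sym (⊞-assoc x y z)) (trans (cong (_⊞ z) (⊞-comm x y)) (⊞-assoc y x z))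

  sumW-─ : ∀ {γ L} (p : γ ∈ L) → sumW e L ≡ γ ⊞ sumW e (L ─ p)
  sumW-─ (here refl) = refl
  sumW-─ {γ} {δ ∷ L} (there p) = trans (cong (δ ⊞_) (sumW-─ p)) (x⊞[y⊞z]≡y⊞[x⊞z] δ γ _)

  sumW-map-─ : ∀ {A : Set} (f : A → Wt e) {x L} (p : x ∈ L) → sumW e (map f L) ≡ f x ⊞ sumW e (map f (L ─ p))
  sumW-map-─ f (here refl) = refl
  sumW-map-─ f {x} {y ∷ L} (there p) = trans (cong (f y ⊞_) (sumW-map-─ f p)) (x⊞[y⊞z]≡y⊞[x⊞z] (f y) (f x) _)

  sumWhere : (ℕ → Bool) → (ℕ → Wt e) → ℕ → Wt e
  sumWhere x f zero    = zeroW e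
  sumWhere x f (suc j) = sumWhere x f j ⊞ (if x j then f j else zeroW e)

  sumWhere-cong : ∀ x {f g} n → (∀ {j} → j < n → f j ≡ g j) → sumWhere x f n ≡ sumWhere x g n
  sumWhere-cong x zero    f≗g = refl
  sumWhere-cong x (suc n) f≗g = cong₂ _⊞_ (sumWhere-cong x n (λ j<n → f≗g (<-trans j<n (n<1+n n))))
                                         (cong (if x n then_else zeroW e) (f≗g (n<1+n n)))

  sumW-reindex : ∀ {A : Set} (f : A → Wt e) (z : ℕ → A) (x : ℕ → Bool) n →
    (∀ {p q} → p < n → q < n → z p ≡ z q → p ≡ q) → ∀ {L} → Unique L →
    (∀ {u} → u ∈ L → Σ ℕ λ j → j < n × x j ≡ true × z j ≡ u) →
    (∀ {j} → j < n → x j ≡ true → z j ∈ L) →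
    sumW e (map f L) ≡ sumWhere x (λ j → f (z j)) n
  sumW-reindex f z x zero _ {[]} _ _ _ = refl
  sumW-reindex f z x zero _ {u ∷ L} _ enumerated _ with () ← proj₁ (proj₂ (enumerated (here refl)))
  sumW-reindex f z x (suc m) injective {L} unique enumerated enumerates with x m in xm
  ... | true = begin
      sumW e (map f L)                                 ≡⟨ sumW-map-─ f zm∈L ⟩
      f (z m) ⊞ sumW e (map f (L ─ zm∈L))              ≡⟨ ⊞-comm _ _ ⟩
      sumW e (map f (L ─ zm∈L)) ⊞ f (z m)              ≡⟨ cong (_⊞ f (z m)) rest ⟩
      sumWhere x (λ j → f (z j)) m ⊞ f (z m)           ∎
    where
    open ≡-Reasoning
    zm∈L = enumerates (n<1+n m) xm
    rest = sumW-reindex f z x m (λ p<m q<m → injective (m<n⇒m<1+n p<m) (m<n⇒m<1+n q<m)) (Unique-─ zm∈L unique)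
      (λ u∈ → let j , j<1+m , xj , zj≡u = enumerated (∈-─⁻ zm∈L u∈) in
        j , ≤∧≢⇒< (ℕ.s≤s⁻¹ j<1+m) (λ j≡m → ∉-─ zm∈L unique (subst (_∈ L ─ zm∈L) (trans (sym zj≡u) (cong z j≡m)) u∈)) , xj , zj≡u)
      (λ j<m xj → ∈-─⁺ zm∈L (enumerates (m<n⇒m<1+n j<m) xj) (λ eq → <-irrefl (injective (m<n⇒m<1+n j<m) (n<1+n m) eq) j<m))
  ... | false = trans rest (sym (⊞-identityʳ _))
    where
    rest = sumW-reindex f z x m (λ p<m q<m → injective (m<n⇒m<1+n p<m) (m<n⇒m<1+n q<m)) unique
      (λ u∈ → let j , j<1+m , xj , zj≡u = enumerated u∈ in
        j , ≤∧≢⇒< (ℕ.s≤s⁻¹ j<1+m) (λ j≡m → case-false (subst (λ k → x k ≡ true) j≡m xj)) , xj , zj≡u)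
      (λ j<m xj → enumerates (m<n⇒m<1+n j<m) xj)
      where
      case-false : x m ≡ true → ⊥
      case-false xm≡true with () ← trans (sym xm) xm≡true

  summand-exceeding : ∀ i j L → lookup (sumW e L) j < lookup (sumW e L) i →
    Σ (Wt e) λ γ → γ ∈ L × lookup γ j < lookup γ i
  summand-exceeding i j [] lt = ⊥-elim (<-irrefl (trans (lookup-zeroW j) (sym (lookup-zeroW i))) lt)
  summand-exceeding i j (γ ∷ L) lt with lookup γ j <? lookup γ i
  ... | yes γ-exceeds = γ , here refl , γ-exceeds
  ... | no ¬γ-exceeds with summand-exceeding i j L (≰⇒> λ sum-i≤sum-j → <⇒≱ lt (begin
        lookup (γ ⊞ sumW e L) i               ≡⟨ lookup-⊞ γ _ i ⟩
        lookup γ i + lookup (sumW e L) i      ≤⟨ +-mono-≤ (≮⇒≥ ¬γ-exceeds) sum-i≤sum-j ⟩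
        lookup γ j + lookup (sumW e L) j      ≡⟨ lookup-⊞ γ _ j ⟨
        lookup (γ ⊞ sumW e L) j               ∎))
    where open ≤-Reasoning
  ... | δ , δ∈L , δ-exceeds = δ , there δ∈L , δ-exceeds

  α-exceeding⇒start : ∀ a p i → lookup (α e a p) (prev i) < lookup (α e a p) i → toℕ i ≡ a % e
  α-exceeding⇒start a p i exceeds = [≡%e]-pos i a (+-cancelˡ-≤ _ 1 _ (begin
    lookup (α e a p) (prev i) + 1                    ≡⟨ +-comm _ 1 ⟩
    suc (lookup (α e a p) (prev i))                  ≤⟨ exceeds ⟩
    lookup (α e a p) i                               ≤⟨ m≤m+n _ _ ⟩
    lookup (α e a p) i + [ i ≡ a + p %e]             ≡⟨ balance ⟩
    lookup (α e a p) (prev i) + [ i ≡ a %e]          ∎))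
    where
    open ≤-Reasoning
    balance : lookup (α e a p) i + [ i ≡ a + p %e] ≡ lookup (α e a p) (prev i) + [ i ≡ a %e]
    balance = subst (λ k → lookup (α e a p) k + [ k ≡ a + p %e] ≡ lookup (α e a p) (prev i) + [ k ≡ a %e])
                    (next-prev i) (α-balance (prev i) a p)

  -- If e ∣ h all strings of length h coincide; otherwise the summand whose coefficient at the
  -- residue of s exceeds the one at the preceding residue must itself start at s.
  summand-at-start : ∀ L s h → 1 ≤ h → All (PosRoot e) L → sumW e L ≡ α e s h →
    Σ (Wt e) λ γ → γ ∈ L × Σ ℕ λ a → Σ ℕ λ p → γ ≡ α e a p × 1 ≤ p × α e s h ≡ α e a h
  summand-at-start [] s h h≥1 _ eq = ⊥-elim (<-irrefl (trans (sym ht-zeroW) (trans (cong (ht e) eq) (ht-α s h))) h≥1)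
  summand-at-start (γ ∷ L) s h h≥1 roots@((t , p , p≥1 , γ≡) ∷ _) eq with e ∣? h
  ... | yes e∣h = γ , here refl , toℕ t , p , γ≡ , p≥1 , α-start-irrelevant s (toℕ t) h e∣h
  ... | no e∤h with summand-exceeding (residue s) (prev (residue s)) (γ ∷ L)
                      (subst (λ v → lookup v (prev (residue s)) < lookup v (residue s)) (sym eq)
                             (≤-reflexive (sym (α-excess s h e∤h))))
  ... | δ , δ∈ , δ-exceeds with All.lookup roots δ∈
  ... | t′ , p′ , p′≥1 , refl = α e (toℕ t′) p′ , δ∈ , toℕ t′ , p′ , refl , p′≥1 ,
        α-cong h (trans (sym (toℕ-residue s)) (α-exceeding⇒start (toℕ t′) p′ (residue s) δ-exceeds))

  α-remainder : ∀ a p h S → 1 ≤ ht e S → α e a h ≡ α e a p ⊞ S → p < h × S ≡ α e (a + p) (h ∸ p)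
  α-remainder a p h S S≠0 eq = p<h , ⊞-cancelˡ (α e a p) S _ (trans (sym eq) split)
    where
    h≡p+htS : h ≡ p + ht e S
    h≡p+htS = trans (sym (ht-α a h)) (trans (cong (ht e) eq) (trans (ht-⊞ (α e a p) S) (cong (_+ ht e S) (ht-α a p))))
    p<h : p < h
    p<h = subst (p <_) (sym h≡p+htS) (≤-trans (≤-reflexive (+-comm 1 p)) (+-monoʳ-≤ p S≠0))
    split : α e a h ≡ α e a p ⊞ α e (a + p) (h ∸ p)
    split = trans (cong (α e a) (sym (m+[n∸m]≡n (<⇒≤ p<h)))) (α-+ a p (h ∸ p))

  MergeClosed : (Wt e → Set) → Set
  MergeClosed Q = ∀ {γ₁ γ₂} → PosRoot e γ₁ → PosRoot e γ₂ → PosRoot e (γ₁ ⊞ γ₂) → Q γ₁ → Q γ₂ → Q (γ₁ ⊞ γ₂)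

  -- Peel off the summand at the start of α(s, h) and recurse on the rest, which is again a string.
  merge-closed-sum : ∀ {Q} → MergeClosed Q → ∀ L {s h} → 1 ≤ h →
    All (λ γ → PosRoot e γ × Q γ) L → sumW e L ≡ α e s h → Q (α e s h)
  merge-closed-sum {Q} merge L = go (length L) L ≤-refl
    where
    go : ∀ fuel L → length L ≤ fuel → ∀ {s h} → 1 ≤ h →
         All (λ γ → PosRoot e γ × Q γ) L → sumW e L ≡ α e s h → Q (α e s h)
    go fuel L len≤ {s} {h} h≥1 good eq with summand-at-start L s h h≥1 (All.map proj₁ good) eq
    ... | γ , γ∈L , a , p , refl , p≥1 , αsh≡αah = subst Q (sym αsh≡αah) (peel fuel len≤ _ refl)
      where
      Qγ : Q (α e a p)
      Qγ = proj₂ (All.lookup good γ∈L)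
      αah≡ : α e a h ≡ α e a p ⊞ sumW e (L ─ γ∈L)
      αah≡ = trans (sym αsh≡αah) (trans (sym eq) (sumW-─ γ∈L))
      peel : ∀ fuel → length L ≤ fuel → ∀ k → ht e (sumW e (L ─ γ∈L)) ≡ k → Q (α e a h)
      peel _ _ zero ht≡0 = subst Q (sym (trans αah≡ (trans (cong (α e a p ⊞_) (sum≡0⇒≡replicate0 _ ht≡0)) (⊞-identityʳ _)))) Qγ
      peel zero len≤0 (suc _) _ = ⊥-elim (n≮0 (subst (_≤ 0) (length-─ γ∈L) len≤0))
      peel (suc fuel′) len≤ (suc k) ht≡ with α-remainder a p h _ (subst (1 ≤_) (sym ht≡) (s≤s z≤n)) αah≡
      ... | p<h , rest≡ = subst Q (sym split) (merge (α-PosRoot a p p≥1) (α-PosRoot (a + p) (h ∸ p) (m<n⇒0<n∸m p<h))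
              (subst (PosRoot e) split (α-PosRoot a h (≤-trans p≥1 (<⇒≤ p<h)))) Qγ Q-rest)
        where
        split : α e a h ≡ α e a p ⊞ α e (a + p) (h ∸ p)
        split = trans (cong (α e a) (sym (m+[n∸m]≡n (<⇒≤ p<h)))) (α-+ a p (h ∸ p))
        Q-rest : Q (α e (a + p) (h ∸ p))
        Q-rest = go fuel′ (L ─ γ∈L) (ℕ.s≤s⁻¹ (subst (_≤ suc fuel′) (length-─ γ∈L) len≤)) (m<n⇒0<n∸m p<h) (All.─⁺ γ∈L good) rest≡

  cont-applyUpTo : ∀ (f : ℕ → Node) s k → (∀ {i} → i < k → unit e (res e (f i)) ≡ unit e (s + i)) →
                   cont e (applyUpTo f k) ≡ α e s k
  cont-applyUpTo f s zero    _        = refl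
  cont-applyUpTo f s (suc k) residues = begin
    unit e (res e (f 0)) ⊞ cont e (applyUpTo (λ i → f (suc i)) k)  ≡⟨ cong₂ _⊞_ (trans (residues (s≤s z≤n)) (cong (unit e) (+-identityʳ s))) rest ⟩
    unit e s ⊞ α e (suc s) k                                        ≡⟨ α-suc s k ⟨
    α e s (suc k)                                                   ∎
    where
    open ≡-Reasoning
    rest = cont-applyUpTo (λ i → f (suc i)) (suc s) k λ i<k → trans (residues (s≤s i<k)) (cong (unit e) (+-suc s _))

  dual : ConvexPreorder e → ConvexPreorder e
  dual P = record
    { _≽_       = λ x y → y ≽ x
    ; ≽-refl    = ≽-refl
    ; ≽-trans   = λ β γ η pβ pγ pη β≼γ γ≼η → ≽-trans η γ β pη pγ pβ γ≼η β≼γ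
    ; ≽-total   = λ β γ pβ pγ → ≽-total γ β pγ pβ
    ; convex    = λ β γ pβ pγ γ≽β pβ+γ →
        let γ≽γ+β , γ+β≽β = convex γ β pγ pβ γ≽β (subst (PosRoot e) (⊞-comm β γ) pβ+γ)
        in subst (_≽ β) (⊞-comm γ β) γ+β≽β , subst (γ ≽_) (⊞-comm γ β) γ≽γ+β
    ; ≽-antisym = λ β γ pβ pγ → mk⇔ (λ (β≼γ , γ≼β) → Equivalence.to (≽-antisym β γ pβ pγ) (γ≼β , β≼γ))
                                   (λ eqv → let β≽γ , γ≽β = Equivalence.from (≽-antisym β γ pβ pγ) eqv in γ≽β , β≽γ)
    }
    where open ConvexPreorder P

  module _ (P : ConvexPreorder e) where
    open ConvexPreorder P

    ≻-MergeClosed : ∀ {β} → PosRoot e β → MergeClosed (β ≻_)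
    ≻-MergeClosed {β} pβ {γ₁} {γ₂} p₁ p₂ p₁₂ (β≽γ₁ , γ₁⋡β) (β≽γ₂ , γ₂⋡β) with ≽-total γ₁ γ₂ p₁ p₂
    ... | inj₁ γ₁≽γ₂ = ≽-trans β γ₁ _ pβ p₁ p₁₂ β≽γ₁ γ₁≽sum ,
                       λ sum≽β → γ₁⋡β (≽-trans γ₁ _ β p₁ p₁₂ pβ γ₁≽sum sum≽β)
      where γ₁≽sum = proj₁ (convex γ₁ γ₂ p₁ p₂ γ₁≽γ₂ p₁₂)
    ... | inj₂ γ₂≽γ₁ = ≽-trans β γ₂ _ pβ p₂ p₁₂ β≽γ₂ γ₂≽sum ,
                       λ sum≽β → γ₂⋡β (≽-trans γ₂ _ β p₂ p₁₂ pβ γ₂≽sum sum≽β)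
      where γ₂≽sum = subst (γ₂ ≽_) (⊞-comm γ₂ γ₁) (proj₁ (convex γ₂ γ₁ p₂ p₁ γ₂≽γ₁ (subst (PosRoot e) (⊞-comm γ₁ γ₂) p₁₂)))

    ≻-right-summand : ∀ {A S β} → PosRoot e A → PosRoot e S → PosRoot e β → PosRoot e (A ⊞ S) →
      A ≻ β → β ≻ (A ⊞ S) → β ≻ S
    ≻-right-summand {A} {S} {β} pA pS pβ pAS (A≽β , β⋡A) (β≽AS , AS⋡β) with ≽-total S A pS pA
    ... | inj₁ S≽A = ⊥-elim (β⋡A (≽-trans β (A ⊞ S) A pβ pAS pA β≽AS AS≽A))
      where AS≽A = subst (_≽ A) (⊞-comm S A) (proj₂ (convex S A pS pA S≽A (subst (PosRoot e) (⊞-comm A S) pAS)))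
    ... | inj₂ A≽S = ≽-trans β (A ⊞ S) S pβ pAS pS β≽AS AS≽S , λ S≽β → AS⋡β (≽-trans (A ⊞ S) S β pAS pS pβ AS≽S S≽β)
      where AS≽S = proj₂ (convex A S pA pS A≽S pAS)

    ≻-complement : ∀ {A S β} → PosRoot e A → PosRoot e S → PosRoot e β → A ⊞ S ≡ β →
      ¬ (S ≽ β × β ≽ S) → A ≻ β → β ≻ S
    ≻-complement {A} {S} {β} pA pS pβ A⊞S≡β S≁β (A≽β , β⋡A) with ≽-total S A pS pA
    ... | inj₁ S≽A = ⊥-elim (β⋡A (subst (_≽ A) (trans (⊞-comm S A) A⊞S≡β)
                      (proj₂ (convex S A pS pA S≽A (subst (PosRoot e) (trans (sym A⊞S≡β) (⊞-comm A S)) pβ)))))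
    ... | inj₂ A≽S = β≽S , λ S≽β → S≁β (S≽β , β≽S)
      where β≽S = subst (_≽ S) A⊞S≡β (proj₂ (convex A S pA pS A≽S (subst (PosRoot e) (sym A⊞S≡β) pβ)))

    -- Only imaginary roots are equivalent without being equal, and in Ψ the only one is δ,
    -- the lowest imaginary root.
    ht<⇒≁ : ∀ {β X} → InΨ e β → PosRoot e X → ht e X < ht e β → ¬ (X ≽ β × β ≽ X)
    ht<⇒≁ {β} {X} ψ pX ht< X≈β with Equivalence.to (≽-antisym X β pX (InΨ⇒PosRoot ψ)) X≈β
    ... | inj₁ refl = <-irrefl refl ht<
    ... | inj₂ (imag-X , imag-β) with ψ | imag-X
    ...   | inj₁ real | _ = RealRoot⇒¬ImagRoot real imag-β
    ...   | inj₂ refl | m , m≥1 , refl = <-irrefl refl (<-≤-trans ht< (begin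
            ht e (δ e)        ≡⟨ ht-mulδ 1 ⟩
            e ℕ.* 1           ≤⟨ *-monoʳ-≤ e m≥1 ⟩
            e ℕ.* m           ≡⟨ ht-mulδ m ⟨
            ht e (mulδ e m)   ∎))
      where open ≤-Reasoning

    comparable : ∀ {β γ} → InΨ e β → PosRoot e γ → ht e γ < ht e β → γ ≻ β ⊎ β ≻ γ
    comparable ψ pγ ht< with ≽-total _ _ pγ (InΨ⇒PosRoot ψ)
    ... | inj₁ γ≽β = inj₁ (γ≽β , λ β≽γ → ht<⇒≁ ψ pγ ht< (γ≽β , β≽γ))
    ... | inj₂ β≽γ = inj₂ (β≽γ , λ γ≽β → ht<⇒≁ ψ pγ ht< (γ≽β , β≽γ))

    α-comparable : ∀ {β} → InΨ e β → ∀ t j → suc j < ht e β → α e t (suc j) ≻ β ⊎ β ≻ α e t (suc j)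
    α-comparable ψ t j 1+j<n = comparable ψ (α-PosRoot t (suc j) (s≤s z≤n)) (subst (_< _) (sym (ht-α t (suc j))) 1+j<n)

    -- The selected positions form maximal runs; each run is a string below β because it starts
    -- at position 0 or right after a rising edge, and ends at n or right before a falling edge.
    module Runs (t n : ℕ) {β : Wt e} (β≡ : β ≡ α e t n) (ψ : InΨ e β) (x : ℕ → Bool)
      (falling : ∀ j → suc j < n → x j ≡ true → x (suc j) ≡ false → β ≻ α e t (suc j))
      (rising  : ∀ j → suc j < n → x j ≡ false → x (suc j) ≡ true → α e t (suc j) ≻ β)
      (unselected : Σ ℕ λ j → j < n × x j ≡ false) where

      selection : ℕ → Wt e
      selection = sumWhere x (λ j → unit e (t + j))

      Below : Wt e → Set
      Below γ = PosRoot e γ × β ≻ γ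

      StartsRun : ℕ → Set
      StartsRun a = a ≡ 0 ⊎ (1 ≤ a × α e t a ≻ β)

      pβ : PosRoot e β
      pβ = InΨ⇒PosRoot ψ

      α-split : ∀ {a m} → a ≤ m → α e t m ≡ α e t a ⊞ α e (t + a) (m ∸ a)
      α-split {a} a≤m = trans (cong (α e t) (sym (m+[n∸m]≡n a≤m))) (α-+ t a _)

      run-below : ∀ {a m} → a < m → m ≤ n → StartsRun a → (β ≻ α e t m) ⊎ (m ≡ n × 1 ≤ a) →
                  Below (α e (t + a) (m ∸ a))
      run-below {a} {m} a<m m≤n start end = p-run , below start end
        where
        p-run = α-PosRoot (t + a) (m ∸ a) (m<n⇒0<n∸m a<m)
        below : StartsRun a → (β ≻ α e t m) ⊎ (m ≡ n × 1 ≤ a) → β ≻ α e (t + a) (m ∸ a)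
        below (inj₁ refl) (inj₁ β≻αtm) = subst (β ≻_) (cong (λ s → α e s m) (sym (+-identityʳ t))) β≻αtm
        below (inj₁ refl) (inj₂ (_ , ()))
        below (inj₂ (1≤a , αta≻β)) (inj₁ β≻αtm) =
          ≻-right-summand (α-PosRoot t a 1≤a) p-run pβ (subst (PosRoot e) (α-split (<⇒≤ a<m)) (α-PosRoot t m (≤-trans 1≤a (<⇒≤ a<m))))
            αta≻β (subst (β ≻_) (α-split (<⇒≤ a<m)) β≻αtm)
        below (inj₂ (1≤a , αta≻β)) (inj₂ (refl , _)) =
          ≻-complement (α-PosRoot t a 1≤a) p-run pβ (sym (trans β≡ (α-split (<⇒≤ a<m))))
            (ht<⇒≁ ψ p-run (subst₂ _<_ (sym (ht-α (t + a) (n ∸ a))) (sym (trans (cong (ht e) β≡) (ht-α t n)))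
                                       (∸-monoʳ-< {n} {a} {0} 1≤a (<⇒≤ (<-≤-trans a<m m≤n)))))
            αta≻β

      Boundary : ℕ → Set
      Boundary m = m ≡ 0 ⊎ Σ ℕ λ m′ → m ≡ suc m′ × x m′ ≡ false

      data Scan (m : ℕ) : Set where
        between : (L : List (Wt e)) → All Below L → selection m ≡ sumW e L → Boundary m → Scan m
        inside  : (L : List (Wt e)) → All Below L → (a : ℕ) → a < m → (∀ {j} → a ≤ j → j < m → x j ≡ true) →
                  StartsRun a → selection m ≡ sumW e L ⊞ α e (t + a) (m ∸ a) → Scan m

      selection-true : ∀ m → x m ≡ true → selection (suc m) ≡ selection m ⊞ unit e (t + m)
      selection-true m xm = cong (λ b → selection m ⊞ (if b then unit e (t + m) else zeroW e)) xm

      selection-false : ∀ m → x m ≡ false → selection (suc m) ≡ selection m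
      selection-false m xm = trans (cong (λ b → selection m ⊞ (if b then unit e (t + m) else zeroW e)) xm) (⊞-identityʳ _)

      open-run : ∀ {m} → suc m ≤ n → x m ≡ true → Boundary m → StartsRun m
      open-run _     _  (inj₁ m≡0) = inj₁ m≡0
      open-run 1+m≤n xm (inj₂ (m′ , refl , xm′)) = inj₂ (s≤s z≤n , rising m′ 1+m≤n xm′ xm)

      close-run : ∀ {a m} → suc m ≤ n → a < m → (∀ {j} → a ≤ j → j < m → x j ≡ true) → x m ≡ false → β ≻ α e t m
      close-run {m = suc m′} 1+m≤n a<m run xm = falling m′ 1+m≤n (run (ℕ.s≤s⁻¹ a<m) ≤-refl) xm

      scan-step : ∀ m → suc m ≤ n → Scan m → Scan (suc m)
      scan-step m 1+m≤n (between L below eq boundary) with x m in xm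
      ... | false = between L below (trans (selection-false m xm) eq) (inj₂ (m , refl , xm))
      ... | true  = inside L below m ≤-refl (λ m≤j j<1+m → subst (λ k → x k ≡ true) (≤-antisym m≤j (ℕ.s≤s⁻¹ j<1+m)) xm)
          (open-run 1+m≤n xm boundary)
          (trans (selection-true m xm) (cong₂ _⊞_ eq (trans (sym (α-1 (t + m))) (cong (α e (t + m)) (sym (m+n∸n≡m 1 m))))))
      scan-step m 1+m≤n (inside L below a a<m run start eq) with x m in xm
      ... | true = inside L below a (m<n⇒m<1+n a<m) run′ start (begin
            selection (suc m)                                       ≡⟨ selection-true m xm ⟩
            selection m ⊞ unit e (t + m)                            ≡⟨ cong (_⊞ unit e (t + m)) eq ⟩
            (sumW e L ⊞ α e (t + a) (m ∸ a)) ⊞ unit e (t + m)       ≡⟨ ⊞-assoc _ _ _ ⟩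
            sumW e L ⊞ (α e (t + a) (m ∸ a) ⊞ unit e (t + m))       ≡⟨ cong (λ r → sumW e L ⊞ (α e (t + a) (m ∸ a) ⊞ unit e r)) t+m≡ ⟩
            sumW e L ⊞ α e (t + a) (suc (m ∸ a))                    ≡⟨ cong (λ k → sumW e L ⊞ α e (t + a) k) (+-∸-assoc 1 (<⇒≤ a<m)) ⟨
            sumW e L ⊞ α e (t + a) (suc m ∸ a)                      ∎)
        where
        open ≡-Reasoning
        t+m≡ : t + m ≡ t + a + (m ∸ a)
        t+m≡ = trans (cong (_+_ t) (sym (m+[n∸m]≡n (<⇒≤ a<m)))) (sym (+-assoc t a (m ∸ a)))
        run′ : ∀ {j} → a ≤ j → j < suc m → x j ≡ true
        run′ a≤j j<1+m with m≤n⇒m<n∨m≡n (ℕ.s≤s⁻¹ j<1+m)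
        ... | inj₁ j<m  = run a≤j j<m
        ... | inj₂ refl = xm
      ... | false = between (α e (t + a) (m ∸ a) ∷ L)
            (run-below a<m (<⇒≤ 1+m≤n) start (inj₁ (close-run 1+m≤n a<m run xm)) ∷ below)
            (trans (selection-false m xm) (trans eq (⊞-comm _ _))) (inj₂ (m , refl , xm))

      scan : ∀ m → m ≤ n → Scan m
      scan zero    _     = between [] [] refl (inj₁ refl)
      scan (suc m) 1+m≤n = scan-step m 1+m≤n (scan m (<⇒≤ 1+m≤n))

      selection-below : SumOfRoots e P (β ≻_) (selection n)
      selection-below with scan n ≤-refl
      ... | between L below eq _ = L , below , sym eq
      ... | inside L below a a<n run start eq = α e (t + a) (n ∸ a) ∷ L ,
            run-below a<n ≤-refl start (inj₂ (refl , 1≤a a run)) ∷ below , sym (trans eq (⊞-comm _ _))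
        where
        1≤a : ∀ a → (∀ {j} → a ≤ j → j < n → x j ≡ true) → 1 ≤ a
        1≤a (suc _) _   = s≤s z≤n
        1≤a zero    run with () ← trans (sym (run z≤n (proj₁ (proj₂ unselected)))) (proj₂ (proj₂ unselected))

  module OnWalk (P : ConvexPreorder e) {ν : Shape} (ν-skew : SkewShape ν)
                {b : Node} {z : ℕ → Node} {n : ℕ} (through : NEWalkThrough ν b z n) where
    open NEWalkThrough through
    open NEWalkCoordinates z n walk

    t : ℕ
    t = res e b

    z∈ν : ∀ {j} → j < n → z j ∈ ν
    z∈ν j<n = Equivalence.from (members _) (_ , j<n , refl)

    position : ∀ {u} → u ∈ ν → Σ ℕ λ j → j < n × z j ≡ u
    position = Equivalence.to (members _)

    diag-z : ∀ {j} → j < n → diag (z j) ≡ diag b ℤ.+ + j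
    diag-z {j} j<n = begin
      diag (z j)                                   ≡⟨ cong diag (coordinates j j<n) ⟩
      (c₀ ℤ.+ + c j) ℤ.- (r₀ ℤ.- + a j)        ≡⟨ rearrange r₀ c₀ (+ a j) (+ c j) ⟩
      (c₀ ℤ.- r₀) ℤ.+ + (a j + c j)              ≡⟨ cong₂ (λ u k → diag u ℤ.+ + k) starts (a+c≡j j) ⟩
      diag b ℤ.+ + j                             ∎
      where
      open ≡-Reasoning
      rearrange : ∀ r c x y → (c ℤ.+ y) ℤ.- (r ℤ.- x) ≡ (c ℤ.- r) ℤ.+ (x ℤ.+ y)
      rearrange = solve-∀

    unit-res-z : ∀ {j} → j < n → unit e (res e (z j)) ≡ unit e (t + j)
    unit-res-z {j} j<n = unit-cong (begin
      res e (z j) % e                  ≡⟨ m<n⇒m%n≡m (ℤDivMod.n%ℕd<d (diag (z j)) e) ⟩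
      diag (z j) %ℕ e                  ≡⟨ cong (_%ℕ e) (diag-z j<n) ⟩
      (diag b ℤ.+ + j) %ℕ e          ≡⟨ [i+n]%ℕe e (diag b) j ⟩
      (t + j) % e                      ∎)
      where open ≡-Reasoning

    cont-selected : ∀ x {τ} → Unique τ → (∀ u → (u ∈ τ) ⇔ (Σ ℕ λ j → j < n × x j ≡ true × z j ≡ u)) →
                    cont e τ ≡ sumWhere x (λ j → unit e (t + j)) n
    cont-selected x unique τ≡ =
      trans (sumW-reindex (λ u → unit e (res e u)) z x n injective unique (Equivalence.to (τ≡ _)) (λ j<n xj → Equivalence.from (τ≡ _) (_ , j<n , xj , refl)))
            (sumWhere-cong x n unit-res-z)

    cont-segment : ∀ a k → a + k ≤ n → cont e (segment z a k) ≡ α e (t + a) k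
    cont-segment a k a+k≤n = cont-applyUpTo (λ i → z (a + i)) (t + a) k λ {i} i<k →
      trans (unit-res-z (<-≤-trans (+-monoʳ-< a i<k) a+k≤n)) (cong (unit e) (sym (+-assoc t a i)))

    cont-ν : cont e ν ≡ α e t n
    cont-ν = trans (cont-selected (λ _ → true) (proj₁ ν-skew) (λ u → mk⇔ (λ u∈ν → let j , j<n , zj≡u = position u∈ν in j , j<n , refl , zj≡u)
                                                                          (λ (j , j<n , _ , zj≡u) → subst (_∈ ν) zj≡u (z∈ν j<n))))
                   (all n)
      where
      all : ∀ m → sumWhere (λ _ → true) (λ j → unit e (t + j)) m ≡ α e t m
      all zero    = refl
      all (suc m) = cong (_⊞ unit e (t + m)) (all m)

    segment-SkewShape : ∀ a k → a + k ≤ n → SkewShape (segment z a k)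
    segment-SkewShape a k a+k≤n = Unique-segment z a k (λ p< q< → injective (<-≤-trans p< a+k≤n) (<-≤-trans q< a+k≤n)) , skew
      where
      skew : IsSkew (segment z a k)
      skew u v w u∈ w∈ u↘v v↘w with ∈-segment⁻ z u∈ | ∈-segment⁻ z w∈
      ... | p , a≤p , p< , refl | q , a≤q , q< , refl with position (proj₂ ν-skew _ v _ (z∈ν p<n) (z∈ν q<n) u↘v v↘w)
        where p<n = <-≤-trans p< a+k≤n
              q<n = <-≤-trans q< a+k≤n
      ... | i , i<n , refl = ∈-segment⁺ z a≤i i<a+k
        where
        p<n = <-≤-trans p< a+k≤n
        q<n = <-≤-trans q< a+k≤n
        a≤i : a ≤ i
        a≤i with a ≤? i
        ... | yes a≤i = a≤i
        ... | no a≰i  = ⊥-elim (↘-between-lower p<n i<n q<n u↘v v↘w (<-≤-trans (≰⇒> a≰i) a≤p) (<-≤-trans (≰⇒> a≰i) a≤q))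
        i<a+k : i < a + k
        i<a+k with i <? a + k
        ... | yes i< = i<
        ... | no i≮  = ⊥-elim (↘-between-upper p<n i<n q<n u↘v v↘w (<-≤-trans p< (≮⇒≥ i≮)) (<-≤-trans q< (≮⇒≥ i≮)))

    module Split (j : ℕ) (1+j<n : suc j < n) where

      prefix suffix : Shape
      prefix = segment z 0 (suc j)
      suffix = segment z (suc j) (n ∸ suc j)

      1+j+[n∸1+j]≡n : suc j + (n ∸ suc j) ≡ n
      1+j+[n∸1+j]≡n = m+[n∸m]≡n (<⇒≤ 1+j<n)

      in-prefix : ∀ {u} → u ∈ prefix → Σ ℕ λ p → p ≤ j × p < n × z p ≡ u
      in-prefix u∈ with ∈-segment⁻ z u∈
      ... | p , _ , p≤j , zp≡u = p , ℕ.s≤s⁻¹ p≤j , <-trans p≤j 1+j<n , zp≡u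

      in-suffix : ∀ {u} → u ∈ suffix → Σ ℕ λ q → j < q × q < n × z q ≡ u
      in-suffix u∈ with ∈-segment⁻ z u∈
      ... | q , j<q , q< , zq≡u = q , j<q , subst (q <_) 1+j+[n∸1+j]≡n q< , zq≡u

      disjoint : ∀ u → u ∈ prefix → u ∈ suffix → ⊥
      disjoint u u∈pre u∈suf with in-prefix u∈pre | in-suffix u∈suf
      ... | p , p≤j , p<n , refl | q , j<q , q<n , zq≡zp = <-irrefl (injective p<n q<n (sym zq≡zp)) (≤-<-trans p≤j j<q)

      split : ∀ u → (u ∈ ν) ⇔ (u ∈ prefix ⊎ u ∈ suffix)
      split u = mk⇔ to from
        where
        to : u ∈ ν → u ∈ prefix ⊎ u ∈ suffix
        to u∈ν with position u∈ν
        ... | i , i<n , refl with i ≤? j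
        ...   | yes i≤j = inj₁ (∈-segment⁺ z z≤n (s≤s i≤j))
        ...   | no i≰j  = inj₂ (∈-segment⁺ z (≰⇒> i≰j) (subst (i <_) (sym 1+j+[n∸1+j]≡n) i<n))
        from : u ∈ prefix ⊎ u ∈ suffix → u ∈ ν
        from (inj₁ u∈) = let p , _ , p<n , zp≡u = in-prefix u∈ in subst (_∈ ν) zp≡u (z∈ν p<n)
        from (inj₂ u∈) = let q , _ , q<n , zq≡u = in-suffix u∈ in subst (_∈ ν) zq≡u (z∈ν q<n)

      cont-prefix : cont e prefix ≡ α e t (suc j)
      cont-prefix = trans (cont-segment 0 (suc j) (<⇒≤ 1+j<n)) (cong (λ s → α e s (suc j)) (+-identityʳ t))

      prefix-SkewShape : SkewShape prefix
      prefix-SkewShape = segment-SkewShape 0 (suc j) (<⇒≤ 1+j<n)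

      suffix-SkewShape : SkewShape suffix
      suffix-SkewShape = segment-SkewShape (suc j) (n ∸ suc j) (≤-reflexive 1+j+[n∸1+j]≡n)

      prefix≢[] : prefix ≢ []
      prefix≢[] ()

      suffix≢[] : suffix ≢ []
      suffix≢[] with n ∸ suc j | m<n⇒0<n∸m 1+j<n
      ... | suc _ | _ = λ ()

      east-tableau : z (suc j) ≡ E (z j) → Tableau e P ν prefix suffix
      east-tableau east = record
        { skew₁ = prefix-SkewShape ; skew₂ = suffix-SkewShape ; nonempty₁ = prefix≢[] ; nonempty₂ = suffix≢[]
        ; disjoint = disjoint ; union = split ; order = order }
        where
        order : ∀ u v → u ∈ suffix → v ∈ prefix → ¬ (u ↘ v)
        order u v u∈ v∈ u↘v with in-suffix u∈ | in-prefix v∈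
        ... | q , j<q , q<n , refl | p , p≤j , p<n , refl = <-irrefl refl (begin-strict
          c q               ≤⟨ proj₂ (↘⇒ q<n p<n u↘v) ⟩
          c p               ≤⟨ c-mono p≤j ⟩
          c j               <⟨ ≤-reflexive (sym (proj₂ (step-E j east))) ⟩
          c (suc j)         ≤⟨ c-mono j<q ⟩
          c q               ∎)
          where open ≤-Reasoning

      north-tableau : z (suc j) ≡ N (z j) → Tableau e P ν suffix prefix
      north-tableau north = record
        { skew₁ = suffix-SkewShape ; skew₂ = prefix-SkewShape ; nonempty₁ = suffix≢[] ; nonempty₂ = prefix≢[]
        ; disjoint = λ u u∈suf u∈pre → disjoint u u∈pre u∈suf
        ; union = λ u → mk⇔ (swap ∘ Equivalence.to (split u)) (Equivalence.from (split u) ∘ swap)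
        ; order = order }
        where
        order : ∀ u v → u ∈ prefix → v ∈ suffix → ¬ (u ↘ v)
        order u v u∈ v∈ u↘v with in-prefix u∈ | in-suffix v∈
        ... | p , p≤j , p<n , refl | q , j<q , q<n , refl = <-irrefl refl (begin-strict
          a q               ≤⟨ proj₁ (↘⇒ p<n q<n u↘v) ⟩
          a p               ≤⟨ a-mono p≤j ⟩
          a j               <⟨ ≤-reflexive (sym (proj₁ (step-N j north))) ⟩
          a (suc j)         ≤⟨ a-mono j<q ⟩
          a q               ∎)
          where open ≤-Reasoning

  module Cuspidality (P : ConvexPreorder e) {ν : Shape} (ν-skew : SkewShape ν) {β : Wt e} (ψ : InΨ e β) (cont-ν≡β : cont e ν ≡ β)
                     {b : Node} {z : ℕ → Node} (through : NEWalkThrough ν b z (ht e β)) where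
    open ConvexPreorder P
    open NEWalkThrough through
    open OnWalk P ν-skew through

    pβ : PosRoot e β
    pβ = InΨ⇒PosRoot ψ

    SumOfRoots-α : ∀ {Q x} s h → MergeClosed Q → SumOfRoots e P Q x → x ≡ α e s (suc h) → Q (α e s (suc h))
    SumOfRoots-α s h merge (L , good , sum≡x) x≡ = merge-closed-sum merge L {s} {suc h} (s≤s z≤n) good (trans sum≡x x≡)

    ≻-asym : ∀ {γ} → γ ≻ β → β ≻ γ → ⊥
    ≻-asym (γ≽β , _) (_ , γ⋡β) = γ⋡β γ≽β

    cuspidal⇒ZetaSeq : Cuspidal e P ν β → ZetaSeq e P β b z
    cuspidal⇒ZetaSeq cuspidal = starts , λ j 1+j<n → to-north j 1+j<n , to-east j 1+j<n
      where
      to-north : ∀ j → suc j < ht e β → α e t (suc j) ≻ β → z (suc j) ≡ N (z j)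
      to-north j 1+j<n α≻β with walk j 1+j<n
      ... | inj₁ north = north
      ... | inj₂ east  = ⊥-elim (≻-asym α≻β (SumOfRoots-α t j (≻-MergeClosed P pβ)
                                            (proj₁ (cuspidal prefix suffix (east-tableau east))) cont-prefix))
        where open Split j 1+j<n
      to-east : ∀ j → suc j < ht e β → β ≻ α e t (suc j) → z (suc j) ≡ E (z j)
      to-east j 1+j<n β≻α with walk j 1+j<n
      ... | inj₂ east  = east
      ... | inj₁ north = ⊥-elim (≻-asym (SumOfRoots-α t j (≻-MergeClosed (dual P) pβ)
                                          (proj₂ (cuspidal suffix prefix (north-tableau north))) cont-prefix) β≻α)
        where open Split j 1+j<n

    step-comparable : ∀ j → suc j < ht e β → α e t (suc j) ≻ β ⊎ β ≻ α e t (suc j)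
    step-comparable = α-comparable P ψ t

    module _ (Q : ConvexPreorder e) (x : ℕ → Bool) {τ : Shape} (unique : Unique τ)
             (selects : ∀ u → (u ∈ τ) ⇔ (Σ ℕ λ j → j < ht e β × x j ≡ true × z j ≡ u)) where
      open ConvexPreorder Q renaming (_≻_ to _≻′_)

      selected-below :
        (∀ j → suc j < ht e β → x j ≡ true → x (suc j) ≡ false → β ≻′ α e t (suc j)) →
        (∀ j → suc j < ht e β → x j ≡ false → x (suc j) ≡ true → α e t (suc j) ≻′ β) →
        (Σ ℕ λ j → j < ht e β × x j ≡ false) →
        SumOfRoots e Q (β ≻′_) (cont e τ)
      selected-below falling rising unselected =
        subst (SumOfRoots e Q (β ≻′_)) (sym (cont-selected x unique selects))
          (Runs.selection-below Q t (ht e β) (trans (sym cont-ν≡β) cont-ν) ψ x falling rising unselected)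

    module Selection {λ₁ λ₂ : Shape} (T : Tableau e P ν λ₁ λ₂) where
      open Tableau T public

      x : ℕ → Bool
      x j = does (z j ∈? λ₁)

      in₁ : ∀ {j} → x j ≡ true → z j ∈ λ₁
      in₁ {j} xj with z j ∈? λ₁
      in₁ {j} xj | yes z∈ = z∈
      in₁ {j} () | no _

      in₁⁺ : ∀ {j} → z j ∈ λ₁ → x j ≡ true
      in₁⁺ {j} z∈ with z j ∈? λ₁
      ... | yes _ = refl
      ... | no z∉ = ⊥-elim (z∉ z∈)

      in₂ : ∀ {j} → j < ht e β → x j ≡ false → z j ∈ λ₂
      in₂ {j} j<n xj with z j ∈? λ₁ | Equivalence.to (union (z j)) (z∈ν j<n)
      in₂ {j} j<n () | yes _  | _
      in₂ {j} j<n xj | no z∉ | inj₁ z∈ = ⊥-elim (z∉ z∈)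
      in₂ {j} j<n xj | no _  | inj₂ z∈ = z∈

      in₂⁺ : ∀ {j} → z j ∈ λ₂ → x j ≡ false
      in₂⁺ {j} z∈₂ with z j ∈? λ₁
      ... | yes z∈₁ = ⊥-elim (disjoint _ z∈₁ z∈₂)
      ... | no _    = refl

      position₁ : ∀ {u} → u ∈ λ₁ → Σ ℕ λ j → j < ht e β × z j ≡ u
      position₁ u∈ = position (Equivalence.from (union _) (inj₁ u∈))

      position₂ : ∀ {u} → u ∈ λ₂ → Σ ℕ λ j → j < ht e β × z j ≡ u
      position₂ u∈ = position (Equivalence.from (union _) (inj₂ u∈))

      selects₁ : ∀ u → (u ∈ λ₁) ⇔ (Σ ℕ λ j → j < ht e β × x j ≡ true × z j ≡ u)
      selects₁ u = mk⇔ (λ u∈ → let j , j<n , zj≡u = position₁ u∈ in j , j<n , in₁⁺ (subst (_∈ λ₁) (sym zj≡u) u∈) , zj≡u)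
                       (λ (j , _ , xj , zj≡u) → subst (_∈ λ₁) zj≡u (in₁ xj))

      selects₂ : ∀ u → (u ∈ λ₂) ⇔ (Σ ℕ λ j → j < ht e β × not (x j) ≡ true × z j ≡ u)
      selects₂ u = mk⇔ (λ u∈ → let j , j<n , zj≡u = position₂ u∈ in j , j<n , cong not (in₂⁺ (subst (_∈ λ₂) (sym zj≡u) u∈)) , zj≡u)
                       (λ (j , j<n , ¬xj , zj≡u) → subst (_∈ λ₂) zj≡u (in₂ j<n (not-injective ¬xj)))

      unselected₁ : Σ ℕ λ j → j < ht e β × x j ≡ false
      unselected₁ = let u , u∈ = nonempty-element nonempty₂ ; j , j<n , zj≡u = position₂ u∈ in
                    j , j<n , in₂⁺ (subst (_∈ λ₂) (sym zj≡u) u∈)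

      unselected₂ : Σ ℕ λ j → j < ht e β × not (x j) ≡ false
      unselected₂ = let u , u∈ = nonempty-element nonempty₁ ; j , j<n , zj≡u = position₁ u∈ in
                    j , j<n , cong not (in₁⁺ (subst (_∈ λ₁) (sym zj≡u) u∈))

    ZetaSeq⇒cuspidal : ZetaSeq e P β b z → Cuspidal e P ν β
    ZetaSeq⇒cuspidal (_ , zeta) λ₁ λ₂ T =
      selected-below P x (proj₁ skew₁) selects₁ falling rising unselected₁ ,
      selected-below (dual P) (not ∘ x) (proj₁ skew₂) selects₂ falling′ rising′ unselected₂
      where
      open Selection T

      falling : ∀ j → suc j < ht e β → x j ≡ true → x (suc j) ≡ false → β ≻ α e t (suc j)
      falling j 1+j<n xj x1+j with step-comparable j 1+j<n
      ... | inj₂ β≻α = β≻α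
      ... | inj₁ α≻β = ⊥-elim (order _ _ (in₂ 1+j<n x1+j) (in₁ xj) (subst (_↘ z j) (sym (proj₁ (zeta j 1+j<n) α≻β)) (N↘ (z j))))

      rising : ∀ j → suc j < ht e β → x j ≡ false → x (suc j) ≡ true → α e t (suc j) ≻ β
      rising j 1+j<n xj x1+j with step-comparable j 1+j<n
      ... | inj₁ α≻β = α≻β
      ... | inj₂ β≻α = ⊥-elim (order _ _ (in₂ (<-trans (n<1+n j) 1+j<n) xj) (in₁ x1+j) (subst (z j ↘_) (sym (proj₂ (zeta j 1+j<n) β≻α)) (↘E (z j))))

      falling′ : ∀ j → suc j < ht e β → not (x j) ≡ true → not (x (suc j)) ≡ false → α e t (suc j) ≻ β
      falling′ j 1+j<n ¬xj ¬x1+j = rising j 1+j<n (not-injective ¬xj) (not-injective ¬x1+j)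

      rising′ : ∀ j → suc j < ht e β → not (x j) ≡ false → not (x (suc j)) ≡ true → β ≻ α e t (suc j)
      rising′ j 1+j<n ¬xj ¬x1+j = falling j 1+j<n (not-injective ¬xj) (not-injective ¬x1+j)

  ZetaSeq⇒NEWalk : ∀ P {β b z} → InΨ e β → ZetaSeq e P β b z → NEWalk z (ht e β)
  ZetaSeq⇒NEWalk P {b = b} ψ (_ , zeta) j 1+j<n with α-comparable P ψ (res e b) j 1+j<n
  ... | inj₁ α≻β = inj₁ (proj₁ (zeta j 1+j<n) α≻β)
  ... | inj₂ β≻α = inj₂ (proj₂ (zeta j 1+j<n) β≻α)

  IsZeta⇒cuspidal : ∀ P {ν} → SkewShape ν → ∀ {β} → InΨ e β → cont e ν ≡ β → ∀ {b} → IsZeta e P β b ν → Cuspidal e P ν β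
  IsZeta⇒cuspidal P ν-skew ψ cont≡β (z , zeta , members) =
    Cuspidality.ZetaSeq⇒cuspidal P ν-skew ψ cont≡β through zeta
    where
    through = record { walk = ZetaSeq⇒NEWalk P ψ zeta ; starts = proj₁ zeta ; members = members }

  cuspidal⇒IsZeta : ∀ P {ν} → Ribbon ν → ∀ {β} → InΨ e β → cont e ν ≡ β → ∀ {b} → IsSW ν b → Cuspidal e P ν β → IsZeta e P β b ν
  cuspidal⇒IsZeta P {ν} ribbon {β} ψ cont≡β {b} b-SW cuspidal =
    z , Cuspidality.cuspidal⇒ZetaSeq P (proj₁ ribbon) ψ cont≡β through cuspidal , NEWalkThrough.members through
    where
    open RibbonWalk ν ribbon using (z)
    through : NEWalkThrough ν b z (ht e β)
    through = subst (NEWalkThrough ν b z) (trans (sym (ht-cont ν)) (cong (ht e) cont≡β)) (RibbonWalk.through ν ribbon b-SW)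

lemma5p8 : (e : ℕ) {{_ : NonZero e}} → 2 ≤ e → (P : ConvexPreorder e) →
    (ν : Shape) → Ribbon ν → (β : Vec ℕ e) → InΨ e β → cont e ν ≡ β →
    (b : Node) → IsSW ν b →
    Cuspidal e P ν β ⇔ IsZeta e P β b ν
-- The argument works for every e ≥ 1.
lemma5p8 e _ P ν ribbon β ψ cont≡β b b-SW =
  mk⇔ (cuspidal⇒IsZeta e P ribbon ψ cont≡β b-SW) (IsZeta⇒cuspidal e P (proj₁ ribbon) ψ cont≡β)
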